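{- Let $n \geq 0$ and $r \geq 1$ be integers and let $q$ be a permutation such that $S_{n,r}^{q}(321)$ is nonempty. Let $b_1$ be the first entry of $q$ (reading left to right) which plays the role of $2$ in some occurrence of the pattern $321$ in $q$. Let $j$ be the number of entries of $q$ that lie to the left of $b_1$ and are greater than $b_1$, and let $i$ be the number of entries of $q$ that lie to the right of $b_1$ and are smaller than $b_1$. Then there exist integers $s,t$ with $0 \leq s,t < r$ and an injection \[ \phi: S_{n,r}^{q}(321) \hookrightarrow \bigcup_{k = 1}^{n} S_{k - 1 + i,s}(321) \times S_{n-k + j,t}(321). \]
   Context: A permutation $p = p_1\cdots p_n$ contains a pattern $q = q_1\cdots q_k$ if there are indices $n_1 < \dots < n_k$ such that $p_{n_a} < p_{n_b}$ if and only if $q_a < q_b$; each such index sequence is a copy (occurrence) of $q$ in $p$, and $p$ contains $r$ copies of $q$ if there are exactly $r$ such index sequences. $S_{m,r}(321)$ denotes the set of permutations of $\{1,\dots,m\}$ containing exactly $r$ copies of $321$. For a sequence $w$ of $m$ distinct positive integers, $\mathrm{reduce}(w)$ is the permutation of $\{1,\dots,m\}$ whose entries are in the same relative order as $w$. A permutation $p$ is of type $q$ if the subsequence of $p$ consisting of all entries that participate in at least one copy of $321$ reduces to $q$. $S_{n,r}^{q}(321)$ denotes the set of permutations of $\{1,\dots,n\}$ of type $q$ with exactly $r$ copies of $321$. -}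

module Defs where

open import Data.Nat using (ℕ; suc; _<_; _<?_)
open import Data.Fin as F using (Fin)
open import Data.List using (List; length; lookup; map; filter; allFin; cartesianProduct; upTo)
open import Data.List.Relation.Unary.Any using (Any; any?)
open import Data.List.Relation.Binary.Permutation.Propositional using (_↭_)
open import Data.Product using (Σ; ∃; ∃-syntax; _×_; _,_)
open import Data.Product.Relation.Binary.Pointwise.NonDependent using ()
open import Data.Sum using (_⊎_)
open import Relation.Nullary using (¬_; Dec)
open import Relation.Nullary.Decidable using (_×-dec_; _⊎-dec_)
open import Relation.Binary.PropositionalEquality using (_≡_)

-- A permutation of {1,...,n}, represented in one-line notation as a list.
IsPerm : ℕ → List ℕ → Set
IsPerm n p = p ↭ map suc (upTo n)

Pos : List ℕ → Set
Pos p = Fin (length p)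

Is321 : (p : List ℕ) → Pos p → Pos p → Pos p → Set
Is321 p a b c = (a F.< b × b F.< c) × (lookup p b < lookup p a × lookup p c < lookup p b)

is321? : (p : List ℕ) → (t : Pos p × (Pos p × Pos p)) → Dec (Is321 p (Data.Product.proj₁ t) (Data.Product.proj₁ (Data.Product.proj₂ t)) (Data.Product.proj₂ (Data.Product.proj₂ t)))
is321? p (a , b , c) = ((a F.<? b) ×-dec (b F.<? c)) ×-dec ((lookup p b <? lookup p a) ×-dec (lookup p c <? lookup p b))

copies321 : (p : List ℕ) → List (Pos p × (Pos p × Pos p))
copies321 p = filter (is321? p) (cartesianProduct (allFin _) (cartesianProduct (allFin _) (allFin _)))

count321 : List ℕ → ℕ
count321 p = length (copies321 p)

InS : ℕ → ℕ → List ℕ → Set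
InS m r p = IsPerm m p × count321 p ≡ r

InTriple : {p : List ℕ} → Pos p → Pos p × (Pos p × Pos p) → Set
InTriple x (a , b , c) = (x ≡ a ⊎ x ≡ b) ⊎ x ≡ c

inTriple? : {p : List ℕ} → (x : Pos p) → (t : Pos p × (Pos p × Pos p)) → Dec (InTriple {p} x t)
inTriple? x (a , b , c) = ((x F.≟ a) ⊎-dec (x F.≟ b)) ⊎-dec (x F.≟ c)

participates? : (p : List ℕ) → (x : Pos p) → Dec (Any (InTriple {p} x) (copies321 p))
participates? p x = any? (inTriple? {p} x) (copies321 p)

involved321 : List ℕ → List ℕ
involved321 p = map (lookup p) (filter (participates? p) (allFin _))

reduce : List ℕ → List ℕ
reduce w = map (λ x → suc (length (filter (_<? x) w))) w

OfType : List ℕ → List ℕ → Set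
OfType q p = reduce (involved321 p) ≡ q

InSq : ℕ → ℕ → List ℕ → List ℕ → Set
InSq n r q p = IsPerm n p × (OfType q p × count321 p ≡ r)

PlaysTwo : (q : List ℕ) → Pos q → Set
PlaysTwo q b = ∃[ a ] ∃[ c ] Is321 q a b c

IsFirstTwo : (q : List ℕ) → Pos q → Set
IsFirstTwo q b = PlaysTwo q b × (∀ b' → b' F.< b → ¬ PlaysTwo q b')

leftGreater : (q : List ℕ) → Pos q → ℕ
leftGreater q b = length (filter (λ a → (a F.<? b) ×-dec (lookup q b <? lookup q a)) (allFin _))

rightSmaller : (q : List ℕ) → Pos q → ℕ
rightSmaller q b = length (filter (λ c → (b F.<? c) ×-dec (lookup q c <? lookup q b)) (allFin _))

-- Write β for the entry of q at b₁ and, for p of type q, v for the entry of p in the role of β, so that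
-- p = L v R. Let A be the entries of L above v and C those of R below v; φ sends p to k = |L| + 1 and
-- the reductions of L C and A R. As β is the middle entry of a 321 of q, every entry of A and of C lies in a
-- 321 through v, so A and C correspond to the j entries of q left of and above β and the i entries right of
-- and below β. Hence the reduced words have sizes k - 1 + i and n - k + j, and their numbers s and t of
-- 321 copies are those of the corresponding subwords of q, both smaller than r since deleting β destroys a
-- copy. Conversely, an entry a of L lies above v exactly when fewer than j entries of L C exceed a, and
-- dually for R, so φ p determines the relative order of all entries of p, and hence p.

module Submission where

open import Defs

open import Data.Nat using (ℕ; zero; suc; _+_; _∸_; _≤_; _<_; z≤n; s≤s; _<?_)
open import Data.Nat.Properties
open import Data.List using (List; []; _∷_; [_]; _++_; length; map; filter; zip; upTo; applyUpTo; tabulate; allFin; cartesianProduct; lookup; take; drop)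
open import Data.List.Properties using (length-take; length-drop; map-tabulate; tabulate-lookup; ∷-injective; map-applyUpTo; map-cong-local; length-++; length-map; filter-++; filter-accept; filter-reject; filter-none; filter-all; filter-notAll)
open import Data.List.Membership.Propositional using (_∈_; _∉_)
open import Data.List.Membership.Propositional.Properties using (∈-lookup; ∈-allFin; ∈-cartesianProduct⁺; ∈-length; ∈-filter⁺; ∈-filter⁻; ∈-++⁺ˡ; ∈-++⁺ʳ; ∈-++⁻)
open import Data.List.Relation.Unary.All as All using (All)
open import Data.List.Relation.Unary.Any as Any using (Any; here; there; any?)
open import Data.List.Relation.Unary.AllPairs as AllPairs using (AllPairs; []; _∷_)
open import Data.List.Relation.Unary.Linked.Properties using (Linked⇒AllPairs)
open import Data.List.Relation.Unary.Unique.Propositional using (Unique)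
import Data.List.Relation.Unary.Unique.Propositional.Properties as Unique
open import Data.List.Relation.Binary.Permutation.Propositional using (↭⇒↭ₛ; _↭_; ↭-sym; module PermutationReasoning)
open import Data.List.Relation.Binary.Permutation.Propositional.Properties using (↭-length; filter-↭; ∈-resp-↭)
  renaming (map⁺ to ↭-map⁺)
import Data.List.Relation.Binary.Permutation.Setoid.Properties as ↭ₛ
open import Data.Fin as Fin using (Fin; toℕ)
open import Data.Fin.Properties using (toℕ<n)
open import Algebra.Properties.Monoid.Sum +-0-monoid using (sum-syntax; sum-cong-≗)
open import Data.List.Sort ≤-decTotalOrder using (sort; sort-↭; sort-↗)
open import Data.List.Relation.Binary.Sublist.Propositional using (_⊆_; []; _∷_; _∷ʳ_; ⊆-refl; ⊆-trans; from∈)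
open import Data.List.Relation.Binary.Sublist.Propositional.Properties using (filter-⊆; filter⁺; ++⁺; ++⁺ˡ; ++⁺ʳ; length-mono-≤; All-resp-⊆; Any-resp-⊆)
open import Data.Product using (Σ; ∃-syntax; _×_; _,_; proj₁; proj₂)
open import Data.Sum as Sum using (_⊎_; inj₁; inj₂)
open import Data.Empty using (⊥-elim)
open import Function using (_∘_; case_of_)
open import Relation.Nullary using (¬_; Dec; yes; no)
open import Relation.Nullary.Decidable using (_×-dec_; _⊎-dec_)
open import Relation.Unary using (Decidable)
open import Relation.Binary.PropositionalEquality using (_≡_; _≢_; refl; sym; trans; cong; cong₂; subst; subst₂; setoid; module ≡-Reasoning)

module _ {A : Set} {P Q : A → Set} (P? : Decidable P) (Q? : Decidable Q) where

  filter-absorb : ∀ xs → (∀ {x} → x ∈ xs → P x → Q x) → filter P? (filter Q? xs) ≡ filter P? xs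
  filter-absorb [] _ = refl
  filter-absorb (x ∷ xs) P⇒Q with Q? x
  ... | yes _ with P? x
  ...   | yes _ = cong (x ∷_) (filter-absorb xs (P⇒Q ∘ there))
  ...   | no _  = filter-absorb xs (P⇒Q ∘ there)
  filter-absorb (x ∷ xs) P⇒Q | no ¬qx =
    trans (filter-absorb xs (P⇒Q ∘ there)) (sym (filter-reject P? (¬qx ∘ P⇒Q (here refl))))

  filter-comm : ∀ xs → filter P? (filter Q? xs) ≡ filter Q? (filter P? xs)
  filter-comm [] = refl
  filter-comm (x ∷ xs) with Q? x | P? x
  ... | yes qx | yes px = begin
    filter P? (x ∷ filter Q? xs) ≡⟨ filter-accept P? px ⟩
    x ∷ filter P? (filter Q? xs) ≡⟨ cong (x ∷_) (filter-comm xs) ⟩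
    x ∷ filter Q? (filter P? xs) ≡⟨ filter-accept Q? qx ⟨
    filter Q? (x ∷ filter P? xs) ∎
    where open ≡-Reasoning
  ... | yes _ | no ¬px = trans (filter-reject P? ¬px) (filter-comm xs)
  ... | no ¬qx | yes _ = trans (filter-comm xs) (sym (filter-reject Q? ¬qx))
  ... | no _ | no _ = filter-comm xs

  length-filter-mono : ∀ xs → (∀ {x} → P x → Q x) → length (filter P? xs) ≤ length (filter Q? xs)
  length-filter-mono xs P⇒Q = length-mono-≤ (filter⁺ P? Q? (λ { refl → P⇒Q }) (⊆-refl {x = xs}))

  length-filter-strict : ∀ xs → (∀ {x} → P x → Q x) → ∀ {y} → y ∈ xs → Q y → ¬ P y →
    length (filter P? xs) < length (filter Q? xs)
  length-filter-strict xs P⇒Q y∈xs qy ¬py = begin-strict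
    length (filter P? xs)              ≡⟨ cong length (filter-absorb xs (λ _ → P⇒Q)) ⟨
    length (filter P? (filter Q? xs))  <⟨ filter-notAll P? (filter Q? xs) (Any.map (λ { refl → ¬py }) (∈-filter⁺ Q? y∈xs qy)) ⟩
    length (filter Q? xs)              ∎
    where
    open ≤-Reasoning

filter-⊆-filter : ∀ {A : Set} {P : A → Set} (P? : Decidable P) {xs ys} → xs ⊆ ys → filter P? xs ⊆ filter P? ys
filter-⊆-filter P? = filter⁺ P? P? λ { refl p → p }

skip-middle : ∀ {A : Set} (ys : List A) x zs → ys ++ zs ⊆ ys ++ x ∷ zs
skip-middle ys x zs = ++⁺ ⊆-refl (x ∷ʳ ⊆-refl)

module _ {A B : Set} where

  zip-∈ˡ : ∀ {x y} (xs : List A) (ys : List B) → (x , y) ∈ zip xs ys → x ∈ xs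
  zip-∈ˡ (x ∷ xs) (y ∷ ys) (here refl) = here refl
  zip-∈ˡ (x ∷ xs) (y ∷ ys) (there m) = there (zip-∈ˡ xs ys m)

  zip-∈ʳ : ∀ {x y} (xs : List A) (ys : List B) → (x , y) ∈ zip xs ys → y ∈ ys
  zip-∈ʳ (x ∷ xs) (y ∷ ys) (here refl) = here refl
  zip-∈ʳ (x ∷ xs) (y ∷ ys) (there m) = there (zip-∈ʳ xs ys m)

  ∈-zipʳ : ∀ {y} (xs : List A) (ys : List B) → length xs ≡ length ys → y ∈ ys → ∃[ x ] (x , y) ∈ zip xs ys
  ∈-zipʳ (x ∷ xs) (y ∷ ys) _ (here refl) = x , here refl
  ∈-zipʳ (x ∷ xs) (y ∷ ys) eq (there m) = let (x′ , m′) = ∈-zipʳ xs ys (suc-injective eq) m in x′ , there m′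

  zip-++ : ∀ (xs : List A) (ys : List B) {xs′ ys′} → length xs ≡ length ys →
    zip (xs ++ xs′) (ys ++ ys′) ≡ zip xs ys ++ zip xs′ ys′
  zip-++ [] [] _ = refl
  zip-++ (x ∷ xs) (y ∷ ys) eq = cong ((x , y) ∷_) (zip-++ xs ys (suc-injective eq))

module _ {P P′ : ℕ → Set} (P? : Decidable P) (P′? : Decidable P′) where

  Agree : List ℕ → List ℕ → Set
  Agree xs xs′ = ∀ {a a′} → (a , a′) ∈ zip xs xs′ → (P a → P′ a′) × (P′ a′ → P a)

  zip-filter : ∀ xs xs′ → length xs ≡ length xs′ → Agree xs xs′ →
    zip (filter P? xs) (filter P′? xs′) ⊆ zip xs xs′ × length (filter P? xs) ≡ length (filter P′? xs′)
  zip-filter [] [] _ _ = [] , refl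
  zip-filter (x ∷ xs) (x′ ∷ xs′) eq agree with P? x | P′? x′ | zip-filter xs xs′ (suc-injective eq) (agree ∘ there)
  ... | yes _  | yes _   | σ , eq′ = (refl ∷ σ) , cong suc eq′
  ... | yes px | no ¬px′ | _ = ⊥-elim (¬px′ (proj₁ (agree (here refl)) px))
  ... | no ¬px | yes px′ | _ = ⊥-elim (¬px (proj₂ (agree (here refl)) px′))
  ... | no _   | no _    | σ , eq′ = ((x , x′) ∷ʳ σ) , eq′

  ∈-zip-filter : ∀ xs xs′ → Agree xs xs′ → ∀ {b b′} → (b , b′) ∈ zip xs xs′ → P b →
    (b , b′) ∈ zip (filter P? xs) (filter P′? xs′)
  ∈-zip-filter (x ∷ xs) (x′ ∷ xs′) agree m pb with P? x | P′? x′
  ∈-zip-filter (x ∷ xs) (x′ ∷ xs′) agree (here refl) pb | yes _ | yes _ = here refl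
  ∈-zip-filter (x ∷ xs) (x′ ∷ xs′) agree (there m) pb | yes _ | yes _ = there (∈-zip-filter xs xs′ (agree ∘ there) m pb)
  ... | yes px | no ¬px′ = ⊥-elim (¬px′ (proj₁ (agree (here refl)) px))
  ... | no ¬px | yes px′ = ⊥-elim (¬px (proj₂ (agree (here refl)) px′))
  ∈-zip-filter (x ∷ xs) (x′ ∷ xs′) agree (here refl) pb | no ¬px | no _ = ⊥-elim (¬px pb)
  ∈-zip-filter (x ∷ xs) (x′ ∷ xs′) agree (there m) pb | no _ | no _ = ∈-zip-filter xs xs′ (agree ∘ there) m pb

module _ {A B : Set} where

  zip-map-self : ∀ (f : A → B) w {a a′} → (a , a′) ∈ zip w (map f w) → a ∈ w × a′ ≡ f a
  zip-map-self f (x ∷ w) (here refl) = here refl , refl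
  zip-map-self f (x ∷ w) (there m) = let (a∈w , eq) = zip-map-self f w m in there a∈w , eq

  map-≡-zip : ∀ (f g : A → B) xs ys → map f xs ≡ map g ys → ∀ {x y} → (x , y) ∈ zip xs ys → f x ≡ g y
  map-≡-zip f g (x ∷ xs) (y ∷ ys) eq (here refl) = proj₁ (∷-injective eq)
  map-≡-zip f g (x ∷ xs) (y ∷ ys) eq (there m) = map-≡-zip f g xs ys (proj₂ (∷-injective eq)) m

  map-filter : ∀ (f : A → B) {P : A → Set} {Q : B → Set} (P? : Decidable P) (Q? : Decidable Q) →
    (∀ i → P i → Q (f i)) → (∀ i → Q (f i) → P i) → ∀ is → map f (filter P? is) ≡ filter Q? (map f is)
  map-filter f P? Q? P⇒Q Q⇒P [] = refl
  map-filter f P? Q? P⇒Q Q⇒P (i ∷ is) with P? i | Q? (f i)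
  ... | yes _ | yes _ = cong (f i ∷_) (map-filter f P? Q? P⇒Q Q⇒P is)
  ... | yes pi | no ¬qi = ⊥-elim (¬qi (P⇒Q i pi))
  ... | no ¬pi | yes qi = ⊥-elim (¬pi (Q⇒P i qi))
  ... | no _ | no _ = map-filter f P? Q? P⇒Q Q⇒P is

module _ {A : Set} where

  zip-diagonal : ∀ (xs ys : List A) → length xs ≡ length ys → (∀ {a b} → (a , b) ∈ zip xs ys → a ≡ b) → xs ≡ ys
  zip-diagonal [] [] _ _ = refl
  zip-diagonal (x ∷ xs) (y ∷ ys) eq diag = cong₂ _∷_ (diag (here refl)) (zip-diagonal xs ys (suc-injective eq) (diag ∘ there))

  map-≡-fixes : ∀ (f : A → A) {xs} → map f xs ≡ xs → ∀ {a} → a ∈ xs → f a ≡ a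
  map-≡-fixes f {x ∷ xs} eq (here refl) = proj₁ (∷-injective eq)
  map-≡-fixes f {x ∷ xs} eq (there a∈xs) = map-≡-fixes f (proj₂ (∷-injective eq)) a∈xs

  split-at : ∀ (xs : List A) (i : Fin (length xs)) → xs ≡ take (toℕ i) xs ++ lookup xs i ∷ drop (suc (toℕ i)) xs
  split-at (x ∷ xs) Fin.zero = refl
  split-at (x ∷ xs) (Fin.suc i) = cong (x ∷_) (split-at xs i)

  length-take-≤ : ∀ k (xs : List A) → k ≤ length xs → length (take k xs) ≡ k
  length-take-≤ k xs k≤ = trans (length-take k xs) (m≤n⇒m⊓n≡m k≤)

  ∈-take : ∀ (xs : List A) {i j : Fin (length xs)} → i Fin.< j → lookup xs i ∈ take (toℕ j) xs
  ∈-take (x ∷ xs) {Fin.zero} {Fin.suc j} _ = here refl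
  ∈-take (x ∷ xs) {Fin.suc i} {Fin.suc j} (s≤s i<j) = there (∈-take xs i<j)

  ∈-drop : ∀ (xs : List A) {i j : Fin (length xs)} → i Fin.< j → lookup xs j ∈ drop (suc (toℕ i)) xs
  ∈-drop (x ∷ xs) {Fin.zero} {Fin.suc j} _ = ∈-lookup j
  ∈-drop (x ∷ xs) {Fin.suc i} {Fin.suc j} (s≤s i<j) = ∈-drop xs i<j

  lookup-injective : ∀ {xs : List A} → Unique xs → ∀ i j → lookup xs i ≡ lookup xs j → i ≡ j
  lookup-injective {_ ∷ _} _ Fin.zero Fin.zero _ = refl
  lookup-injective {_ ∷ _} (x≢ ∷ _) Fin.zero (Fin.suc j) eq = ⊥-elim (All.lookup x≢ (∈-lookup j) eq)
  lookup-injective {_ ∷ _} (x≢ ∷ _) (Fin.suc i) Fin.zero eq = ⊥-elim (All.lookup x≢ (∈-lookup i) (sym eq))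
  lookup-injective {_ ∷ _} (_ ∷ unique) (Fin.suc i) (Fin.suc j) eq = cong Fin.suc (lookup-injective unique i j eq)

  Unique-⊆ : ∀ {xs ys : List A} → xs ⊆ ys → Unique ys → Unique xs
  Unique-⊆ [] [] = []
  Unique-⊆ (_ ∷ʳ σ) (_ ∷ unique) = Unique-⊆ σ unique
  Unique-⊆ (refl ∷ σ) (x≢ ∷ unique) = All-resp-⊆ σ x≢ ∷ Unique-⊆ σ unique

  Unique-resp-↭ : ∀ {xs ys : List A} → xs ↭ ys → Unique xs → Unique ys
  Unique-resp-↭ σ = ↭ₛ.Unique-resp-↭ (setoid A) (↭⇒↭ₛ σ)

  Unique-middle : ∀ {v} (xs : List A) {ys} → Unique (xs ++ v ∷ ys) → v ∉ xs × v ∉ ys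
  Unique-middle [] (v∉ys ∷ _) = (λ ()) , λ v∈ys → All.lookup v∉ys v∈ys refl
  Unique-middle (x ∷ xs) (x∉ ∷ unique) =
    (λ { (here refl) → All.lookup x∉ (∈-++⁺ʳ xs (here refl)) refl ; (there v∈xs) → proj₁ (Unique-middle xs unique) v∈xs }) ,
    proj₂ (Unique-middle xs unique)

  ++-∷-cancel : ∀ {v} (xs ys xs′ ys′ : List A) → xs ++ v ∷ ys ≡ xs′ ++ v ∷ ys′ → v ∉ xs → v ∉ xs′ → xs ≡ xs′ × ys ≡ ys′
  ++-∷-cancel [] ys [] ys′ eq _ _ = refl , proj₂ (∷-injective eq)
  ++-∷-cancel [] ys (x′ ∷ xs′) ys′ eq _ v∉xs′ = ⊥-elim (v∉xs′ (here (proj₁ (∷-injective eq))))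
  ++-∷-cancel (x ∷ xs) ys [] ys′ eq v∉xs _ = ⊥-elim (v∉xs (here (sym (proj₁ (∷-injective eq)))))
  ++-∷-cancel (x ∷ xs) ys (x′ ∷ xs′) ys′ eq v∉xs v∉xs′ =
    let (x≡x′ , eq′) = ∷-injective eq
        (xs≡ , ys≡) = ++-∷-cancel xs ys xs′ ys′ eq′ (v∉xs ∘ there) (v∉xs′ ∘ there)
    in cong₂ _∷_ x≡x′ xs≡ , ys≡

breakAt : ℕ → List ℕ → List ℕ × List ℕ
breakAt v [] = [] , []
breakAt v (y ∷ ys) with y ≟ v
... | yes _ = [] , ys
... | no _ = y ∷ proj₁ (breakAt v ys) , proj₂ (breakAt v ys)

breakAt-split : ∀ v ys → v ∈ ys → ys ≡ proj₁ (breakAt v ys) ++ v ∷ proj₂ (breakAt v ys) × v ∉ proj₁ (breakAt v ys)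
breakAt-split v (y ∷ ys) v∈ with y ≟ v
... | yes refl = refl , λ ()
breakAt-split v (y ∷ ys) (here refl) | no y≢v = ⊥-elim (y≢v refl)
breakAt-split v (y ∷ ys) (there v∈ys) | no y≢v =
  let (eq , v∉) = breakAt-split v ys v∈ys
  in cong (y ∷_) eq , λ { (here refl) → y≢v refl ; (there v∈) → v∉ v∈ }

-- The entry at index k; 0 when k is out of range.
_!_ : List ℕ → ℕ → ℕ
[] ! k = 0
(x ∷ xs) ! zero = x
(x ∷ xs) ! suc k = xs ! k

split-index : ∀ k (xs : List ℕ) → k < length xs → xs ≡ take k xs ++ xs ! k ∷ drop (suc k) xs
split-index zero (x ∷ xs) _ = refl
split-index (suc k) (x ∷ xs) (s≤s k<) = cong (x ∷_) (split-index k xs k<)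

-- Counting copies of 21 and 321

-- Copies of 321 are counted by their first entry x, as copies of 21 among the later entries below x.
#21 : List ℕ → ℕ
#21 [] = 0
#21 (y ∷ ys) = length (filter (_<? y) ys) + #21 ys

#321 : List ℕ → ℕ
#321 [] = 0
#321 (x ∷ xs) = #21 (filter (_<? x) xs) + #321 xs

Occurs21 : List ℕ → ℕ → ℕ → Set
Occurs21 w y z = (y ∷ z ∷ []) ⊆ w × z < y

Occurs321 : List ℕ → ℕ → ℕ → ℕ → Set
Occurs321 w x y z = (x ∷ y ∷ z ∷ []) ⊆ w × y < x × z < y

#21-none : ∀ ys → (∀ {y z} → ¬ Occurs21 ys y z) → #21 ys ≡ 0
#21-none [] _ = refl
#21-none (y ∷ ys) noInv
  rewrite filter-none (_<? y) (All.tabulate λ z∈ys z<y → noInv ((refl ∷ from∈ z∈ys) , z<y)) =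
  #21-none ys λ (σ , z<y) → noInv ((y ∷ʳ σ) , z<y)

#21-restrict : ∀ {Q : ℕ → Set} (Q? : Decidable Q) ys →
  (∀ {y z} → Occurs21 ys y z → Q y × Q z) → #21 ys ≡ #21 (filter Q? ys)
#21-restrict Q? [] _ = refl
#21-restrict Q? (y ∷ ys) inQ with Q? y
... | yes _ = cong₂ _+_
  (cong length (sym (filter-absorb (_<? y) Q? ys λ z∈ys z<y → proj₂ (inQ ((refl ∷ from∈ z∈ys) , z<y)))))
  (#21-restrict Q? ys λ (σ , z<y) → inQ ((y ∷ʳ σ) , z<y))
... | no ¬qy
  rewrite filter-none (_<? y) (All.tabulate λ z∈ys z<y → ¬qy (proj₁ (inQ ((refl ∷ from∈ z∈ys) , z<y)))) =
  #21-restrict Q? ys λ (σ , z<y) → inQ ((y ∷ʳ σ) , z<y)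

Occurs21⇒Occurs321 : ∀ {x xs y z} → Occurs21 (filter (_<? x) xs) y z → Occurs321 (x ∷ xs) x y z
Occurs21⇒Occurs321 {x} {xs} (σ , z<y) =
  (refl ∷ ⊆-trans σ (filter-⊆ (_<? x) xs)) , proj₂ (∈-filter⁻ (_<? x) {xs = xs} (Any-resp-⊆ σ (here refl))) , z<y

#321-restrict : ∀ {Q : ℕ → Set} (Q? : Decidable Q) xs →
  (∀ {x y z} → Occurs321 xs x y z → Q x × Q y × Q z) → #321 xs ≡ #321 (filter Q? xs)
#321-restrict Q? [] _ = refl
#321-restrict Q? (x ∷ xs) inQ with Q? x
... | yes _ = cong₂ _+_
  (trans (#21-restrict Q? (filter (_<? x) xs) (proj₂ ∘ inQ ∘ Occurs21⇒Occurs321)) (cong #21 (filter-comm Q? (_<? x) xs)))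
  (#321-restrict Q? xs λ (σ , lt) → inQ ((x ∷ʳ σ) , lt))
... | no ¬qx = cong₂ _+_
  (#21-none (filter (_<? x) xs) (¬qx ∘ proj₁ ∘ inQ ∘ Occurs21⇒Occurs321))
  (#321-restrict Q? xs λ (σ , lt) → inQ ((x ∷ʳ σ) , lt))

#21-mono : ∀ {xs ys} → xs ⊆ ys → #21 xs ≤ #21 ys
#21-mono [] = z≤n
#21-mono (y ∷ʳ σ) = ≤-trans (#21-mono σ) (m≤n+m _ _)
#21-mono (_∷_ {x = x} refl σ) = +-mono-≤ (length-mono-≤ (filter-⊆-filter (_<? x) σ)) (#21-mono σ)

#321-mono : ∀ {xs ys} → xs ⊆ ys → #321 xs ≤ #321 ys
#321-mono [] = z≤n
#321-mono (y ∷ʳ σ) = ≤-trans (#321-mono σ) (m≤n+m _ _)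
#321-mono (_∷_ {x = x} refl σ) = +-mono-≤ (#21-mono (filter-⊆-filter (_<? x) σ)) (#321-mono σ)

#21-insert-strict : ∀ ys x zs {c} → c ∈ zs → c < x → #21 (ys ++ zs) < #21 (ys ++ x ∷ zs)
#21-insert-strict [] x zs c∈zs c<x = +-mono-<-≤ (∈-length (∈-filter⁺ (_<? x) c∈zs c<x)) ≤-refl
#21-insert-strict (y ∷ ys) x zs c∈zs c<x =
  +-mono-≤-< (length-mono-≤ (filter-⊆-filter (_<? y) (skip-middle ys x zs))) (#21-insert-strict ys x zs c∈zs c<x)

#321-insert-strict : ∀ ys x zs {a c} → a ∈ ys → x < a → c ∈ zs → c < x → #321 (ys ++ zs) < #321 (ys ++ x ∷ zs)
#321-insert-strict (y ∷ ys) x zs (here refl) x<y c∈zs c<x = +-mono-<-≤ (begin-strict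
    #21 (filter (_<? y) (ys ++ zs))                          ≡⟨ cong #21 (filter-++ (_<? y) ys zs) ⟩
    #21 (filter (_<? y) ys ++ filter (_<? y) zs)             <⟨ #21-insert-strict (filter (_<? y) ys) x _ (∈-filter⁺ (_<? y) c∈zs (<-trans c<x x<y)) c<x ⟩
    #21 (filter (_<? y) ys ++ x ∷ filter (_<? y) zs)         ≡⟨ cong (λ l → #21 (filter (_<? y) ys ++ l)) (filter-accept (_<? y) x<y) ⟨
    #21 (filter (_<? y) ys ++ filter (_<? y) (x ∷ zs))       ≡⟨ cong #21 (filter-++ (_<? y) ys (x ∷ zs)) ⟨
    #21 (filter (_<? y) (ys ++ x ∷ zs))                      ∎)
  (#321-mono (skip-middle ys x zs))
  where open ≤-Reasoning
#321-insert-strict (y ∷ ys) x zs (there a∈ys) x<a c∈zs c<x =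
  +-mono-≤-< (#21-mono (filter-⊆-filter (_<? y) (skip-middle ys x zs))) (#321-insert-strict ys x zs a∈ys x<a c∈zs c<x)

-- Patterns and reduction

OrderIso : List (ℕ × ℕ) → Set
OrderIso Z = ∀ {a a′ b b′} → (a , a′) ∈ Z → (b , b′) ∈ Z → (a < b → a′ < b′) × (a′ < b′ → a < b)

SamePattern : List ℕ → List ℕ → Set
SamePattern xs ys = length xs ≡ length ys × OrderIso (zip xs ys)

module _ {xs ys : List ℕ} (sp : SamePattern xs ys) {a a′} (m : (a , a′) ∈ zip xs ys) where

  SamePattern-#below : length (filter (_<? a) xs) ≡ length (filter (_<? a′) ys)
  SamePattern-#below = proj₂ (zip-filter (_<? a) (_<? a′) xs ys (proj₁ sp) (λ m′ → proj₂ sp m′ m))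

  SamePattern-#above : length (filter (a <?_) xs) ≡ length (filter (a′ <?_) ys)
  SamePattern-#above = proj₂ (zip-filter (a <?_) (a′ <?_) xs ys (proj₁ sp) (proj₂ sp m))

OrderIso-⊆ : ∀ {Z Z′} → Z′ ⊆ Z → OrderIso Z → OrderIso Z′
OrderIso-⊆ σ iso m m′ = iso (Any-resp-⊆ σ m) (Any-resp-⊆ σ m′)

SamePattern-tail : ∀ {x y xs ys} → SamePattern (x ∷ xs) (y ∷ ys) → SamePattern xs ys
SamePattern-tail (eq , iso) = suc-injective eq , λ m m′ → iso (there m) (there m′)

#21-pattern : ∀ xs ys → SamePattern xs ys → #21 xs ≡ #21 ys
#21-pattern [] [] _ = refl
#21-pattern (x ∷ xs) (y ∷ ys) sp = cong₂ _+_
  (proj₂ (zip-filter (_<? x) (_<? y) xs ys (proj₁ (SamePattern-tail sp)) λ m → proj₂ sp (there m) (here refl)))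
  (#21-pattern xs ys (SamePattern-tail sp))

#321-pattern : ∀ xs ys → SamePattern xs ys → #321 xs ≡ #321 ys
#321-pattern [] [] _ = refl
#321-pattern (x ∷ xs) (y ∷ ys) sp =
  let (σ , eq) = zip-filter (_<? x) (_<? y) xs ys (proj₁ (SamePattern-tail sp)) λ m → proj₂ sp (there m) (here refl)
  in cong₂ _+_ (#21-pattern _ _ (eq , OrderIso-⊆ σ (proj₂ (SamePattern-tail sp)))) (#321-pattern xs ys (SamePattern-tail sp))

-- reduce w is map (rank w) w by definition.
rank : List ℕ → ℕ → ℕ
rank w x = suc (length (filter (_<? x) w))

rank-< : ∀ w {a b} → a ∈ w → a < b → rank w a < rank w b
rank-< w {a} {b} a∈w a<b = s≤s (length-filter-strict (_<? a) (_<? b) w (λ x<a → <-trans x<a a<b) a∈w a<b (<-irrefl refl))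

rank-mono-≤ : ∀ w {a b} → a ≤ b → rank w a ≤ rank w b
rank-mono-≤ w a≤b = s≤s (length-filter-mono (_<? _) (_<? _) w (λ x<a → <-≤-trans x<a a≤b))

rank-cancel-< : ∀ w {a b} → rank w a < rank w b → a < b
rank-cancel-< w {a} {b} lt with a <? b
... | yes a<b = a<b
... | no a≮b = ⊥-elim (<⇒≱ lt (rank-mono-≤ w (≮⇒≥ a≮b)))

SamePattern-reduce : ∀ w → SamePattern w (reduce w)
SamePattern-reduce w = sym (length-map (rank w) w) , λ ma mb →
  case zip-map-self (rank w) w ma , zip-map-self (rank w) w mb of λ where
    ((a∈w , refl) , (_ , refl)) → rank-< w a∈w , rank-cancel-< w

reduce-injective : ∀ w w′ → reduce w ≡ reduce w′ → SamePattern w w′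
reduce-injective w w′ eq = length-eq , iso
  where
  length-eq : length w ≡ length w′
  length-eq = trans (sym (length-map (rank w) w)) (trans (cong length eq) (length-map (rank w′) w′))
  iso : OrderIso (zip w w′)
  iso ma mb with map-≡-zip (rank w) (rank w′) w w′ eq ma | map-≡-zip (rank w) (rank w′) w w′ eq mb
  ... | ea | eb =
    (λ a<b → rank-cancel-< w′ (subst₂ _<_ ea eb (rank-< w (zip-∈ˡ w w′ ma) a<b))) ,
    (λ a′<b′ → rank-cancel-< w (subst₂ _<_ (sym ea) (sym eb) (rank-< w′ (zip-∈ʳ w w′ ma) a′<b′)))

-- Permutations of 1..n

interval : ℕ → ℕ → List ℕ
interval m zero = []
interval m (suc n) = m ∷ interval (suc m) n

length-interval : ∀ m n → length (interval m n) ≡ n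
length-interval m zero = refl
length-interval m (suc n) = cong suc (length-interval (suc m) n)

applyUpTo-interval : ∀ (f : ℕ → ℕ) m n → (∀ i → f i ≡ m + i) → applyUpTo f n ≡ interval m n
applyUpTo-interval f m zero _ = refl
applyUpTo-interval f m (suc n) f≗m+ = cong₂ _∷_ (trans (f≗m+ 0) (+-identityʳ m))
  (applyUpTo-interval (f ∘ suc) (suc m) n λ i → trans (f≗m+ (suc i)) (+-suc m i))

map-suc-upTo : ∀ n → map suc (upTo n) ≡ interval 1 n
map-suc-upTo n = trans (map-applyUpTo (λ i → i) suc n) (applyUpTo-interval suc 1 n λ _ → refl)

∈-interval⁻ : ∀ m n {x} → x ∈ interval m n → m ≤ x
∈-interval⁻ m (suc n) (here refl) = ≤-refl
∈-interval⁻ m (suc n) (there x∈) = <⇒≤ (∈-interval⁻ (suc m) n x∈)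

interval-sorted : ∀ m n → AllPairs _<_ (interval m n)
interval-sorted m zero = []
interval-sorted m (suc n) = All.tabulate (∈-interval⁻ (suc m) n) ∷ interval-sorted (suc m) n

sorted-ranks : ∀ {ws} → AllPairs _<_ ws → ∀ m → map (λ x → m + length (filter (_<? x) ws)) ws ≡ interval m (length ws)
sorted-ranks [] m = refl
sorted-ranks {x ∷ xs} (x<xs ∷ sorted) m =
  cong₂ _∷_ head-rank (trans (map-cong-local (All.map tail-rank x<xs)) (sorted-ranks sorted (suc m)))
  where
  head-rank : m + length (filter (_<? x) (x ∷ xs)) ≡ m
  head-rank rewrite filter-reject (_<? x) {xs = xs} (<-irrefl refl)
                  | filter-none (_<? x) (All.map (λ x<y y<x → <-asym x<y y<x) x<xs) = +-identityʳ m
  tail-rank : ∀ {y} → x < y → m + length (filter (_<? y) (x ∷ xs)) ≡ suc m + length (filter (_<? y) xs)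
  tail-rank x<y rewrite filter-accept (_<? _) {xs = xs} x<y = +-suc m _

interval-rank : ∀ m n {a} → a ∈ interval m n → m + length (filter (_<? a) (interval m n)) ≡ a
interval-rank m n = map-≡-fixes _ (trans (sorted-ranks (interval-sorted m n) m) (cong (interval m) (length-interval m n)))

IsPerm-interval : ∀ {n p} → IsPerm n p → p ↭ interval 1 n
IsPerm-interval {n} = subst (_ ↭_) (map-suc-upTo n)

IsPerm-unique : ∀ {n p} → IsPerm n p → Unique p
IsPerm-unique {n} perm = Unique-resp-↭ (↭-sym (IsPerm-interval perm)) (AllPairs.map <⇒≢ (interval-sorted 1 n))

IsPerm-length : ∀ {n p} → IsPerm n p → length p ≡ n
IsPerm-length {n} perm = trans (↭-length (IsPerm-interval perm)) (length-interval 1 n)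

IsPerm-rank : ∀ {n p} → IsPerm n p → ∀ {a} → a ∈ p → rank p a ≡ a
IsPerm-rank {n} perm {a} a∈p = trans (cong suc (↭-length (filter-↭ (_<? a) (IsPerm-interval perm))))
  (interval-rank 1 n (∈-resp-↭ (IsPerm-interval perm) a∈p))

-- Each entry of a permutation of 1..n equals its rank.
IsPerm-pattern-injective : ∀ {n p p′} → IsPerm n p → IsPerm n p′ → OrderIso (zip p p′) → p ≡ p′
IsPerm-pattern-injective {n} {p} {p′} perm perm′ iso = zip-diagonal p p′ same-length λ {a} {b} m → begin
  a            ≡⟨ IsPerm-rank perm (zip-∈ˡ p p′ m) ⟨
  rank p a     ≡⟨ cong suc (SamePattern-#below (same-length , iso) m) ⟩
  rank p′ b    ≡⟨ IsPerm-rank perm′ (zip-∈ʳ p p′ m) ⟩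
  b            ∎
  where
  open ≡-Reasoning
  same-length : length p ≡ length p′
  same-length = trans (IsPerm-length perm) (sym (IsPerm-length perm′))

-- Sorting w does not change ranks, and a strictly increasing list has ranks 1, 2, 3, ...
reduce-IsPerm : ∀ w → Unique w → IsPerm (length w) (reduce w)
reduce-IsPerm w unique = subst (reduce w ↭_) (sym (map-suc-upTo (length w))) (begin
  map (rank w) w            ↭⟨ ↭-map⁺ (rank w) (↭-sym (sort-↭ w)) ⟩
  map (rank w) ws           ≡⟨ map-cong-local (All.tabulate λ {x} _ → cong suc (↭-length (filter-↭ (_<? x) (↭-sym (sort-↭ w))))) ⟩
  map (rank ws) ws          ≡⟨ sorted-ranks ws-sorted 1 ⟩
  interval 1 (length ws)    ≡⟨ cong (interval 1) (↭-length (sort-↭ w)) ⟩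
  interval 1 (length w)     ∎)
  where
  open PermutationReasoning
  ws : List ℕ
  ws = sort w
  ws-sorted : AllPairs _<_ ws
  ws-sorted = AllPairs.zipWith (λ (x≤y , x≢y) → ≤∧≢⇒< x≤y x≢y)
    (Linked⇒AllPairs ≤-trans (sort-↗ w) , Unique-resp-↭ (↭-sym (sort-↭ w)) unique)

-- Counting by positions

𝟙 : ∀ {P : Set} → Dec P → ℕ
𝟙 (yes _) = 1
𝟙 (no _) = 0

𝟙-cong : ∀ {P Q : Set} → (P → Q) → (Q → P) → (p : Dec P) (q : Dec Q) → 𝟙 p ≡ 𝟙 q
𝟙-cong _ _ (yes _) (yes _) = refl
𝟙-cong P⇒Q _ (yes p) (no ¬q) = ⊥-elim (¬q (P⇒Q p))
𝟙-cong _ Q⇒P (no ¬p) (yes q) = ⊥-elim (¬p (Q⇒P q))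
𝟙-cong _ _ (no _) (no _) = refl

𝟙-no : ∀ {P : Set} → ¬ P → (p : Dec P) → 𝟙 p ≡ 0
𝟙-no ¬p (yes p) = ⊥-elim (¬p p)
𝟙-no ¬p (no _) = refl

∑-zero : ∀ n {f : Fin n → ℕ} → (∀ i → f i ≡ 0) → ∑[ i < n ] f i ≡ 0
∑-zero zero _ = refl
∑-zero (suc n) f≗0 = cong₂ _+_ (f≗0 Fin.zero) (∑-zero n (f≗0 ∘ Fin.suc))

∑-tail : ∀ n {f : Fin (suc n) → ℕ} → f Fin.zero ≡ 0 → ∑[ i < suc n ] f i ≡ ∑[ i < n ] f (Fin.suc i)
∑-tail n {f} f0≡0 = cong (_+ ∑[ i < n ] f (Fin.suc i)) f0≡0

module _ {A : Set} {P : A → Set} (P? : Decidable P) where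

  length-filter-tabulate : ∀ {n} (f : Fin n → A) → length (filter P? (tabulate f)) ≡ ∑[ i < n ] 𝟙 (P? (f i))
  length-filter-tabulate {zero} f = refl
  length-filter-tabulate {suc n} f with P? (f Fin.zero)
  ... | yes _ = cong suc (length-filter-tabulate (f ∘ Fin.suc))
  ... | no _ = length-filter-tabulate (f ∘ Fin.suc)

  length-filter-lookup : ∀ ys → ∑[ i < length ys ] 𝟙 (P? (lookup ys i)) ≡ length (filter P? ys)
  length-filter-lookup ys = trans (sym (length-filter-tabulate (lookup ys))) (cong (length ∘ filter P?) (tabulate-lookup ys))

  length-filter-∷ : ∀ x xs → length (filter P? (x ∷ xs)) ≡ 𝟙 (P? x) + length (filter P? xs)
  length-filter-∷ x xs with P? x
  ... | yes _ = refl
  ... | no _ = refl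

  length-filter-map : ∀ {B : Set} (g : B → A) ys → length (filter P? (map g ys)) ≡ length (filter (P? ∘ g) ys)
  length-filter-map g [] = refl
  length-filter-map g (y ∷ ys) with P? (g y)
  ... | yes _ = cong suc (length-filter-map g ys)
  ... | no _ = length-filter-map g ys

length-filter-cartesianProduct : ∀ {A B : Set} {P : A × B → Set} (P? : Decidable P) {n} (f : Fin n → A) (ys : List B) →
  length (filter P? (cartesianProduct (tabulate f) ys)) ≡ ∑[ i < n ] length (filter (λ y → P? (f i , y)) ys)
length-filter-cartesianProduct P? {zero} f ys = refl
length-filter-cartesianProduct P? {suc n} f ys = begin
  length (filter P? (map (f Fin.zero ,_) ys ++ cartesianProduct (tabulate (f ∘ Fin.suc)) ys))
    ≡⟨ cong length (filter-++ P? (map (f Fin.zero ,_) ys) _) ⟩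
  length (filter P? (map (f Fin.zero ,_) ys) ++ filter P? (cartesianProduct (tabulate (f ∘ Fin.suc)) ys))
    ≡⟨ length-++ (filter P? (map (f Fin.zero ,_) ys)) ⟩
  length (filter P? (map (f Fin.zero ,_) ys)) + length (filter P? (cartesianProduct (tabulate (f ∘ Fin.suc)) ys))
    ≡⟨ cong₂ _+_ (length-filter-map P? (f Fin.zero ,_) ys) (length-filter-cartesianProduct P? (f ∘ Fin.suc) ys) ⟩
  _ ∎
  where open ≡-Reasoning

∑321 : List ℕ → ℕ
∑321 w = ∑[ a < length w ] ∑[ b < length w ] ∑[ c < length w ] 𝟙 (is321? w (a , b , c))

count321≡∑321 : ∀ w → count321 w ≡ ∑321 w
count321≡∑321 w = begin
  length (filter (is321? w) (cartesianProduct (allFin n) (cartesianProduct (allFin n) (allFin n))))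
    ≡⟨ length-filter-cartesianProduct (is321? w) (λ a → a) _ ⟩
  ∑[ a < n ] length (filter (λ t → is321? w (a , t)) (cartesianProduct (allFin n) (allFin n)))
    ≡⟨ sum-cong-≗ (λ a → length-filter-cartesianProduct (λ t → is321? w (a , t)) (λ b → b) (allFin n)) ⟩
  ∑[ a < n ] ∑[ b < n ] length (filter (λ c → is321? w (a , b , c)) (allFin n))
    ≡⟨ sum-cong-≗ (λ a → sum-cong-≗ λ b → length-filter-tabulate (λ c → is321? w (a , b , c)) (λ c → c)) ⟩
  ∑321 w ∎
  where
  open ≡-Reasoning
  n : ℕ
  n = length w

∑21-below : ℕ → List ℕ → ℕ
∑21-below x w = ∑[ b < length w ] ∑[ c < length w ]
  𝟙 (((b Fin.<? c) ×-dec (lookup w b <? x)) ×-dec (lookup w c <? lookup w b))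

∑321-step : ∀ x xs → ∑321 (x ∷ xs) ≡ ∑21-below x xs + ∑321 xs
∑321-step x xs = cong₂ _+_ first-at-head (sum-cong-≗ first-in-tail)
  where
  open ≡-Reasoning
  n : ℕ
  n = length xs
  w : List ℕ
  w = x ∷ xs
  first-at-head : ∑[ b < suc n ] ∑[ c < suc n ] 𝟙 (is321? w (Fin.zero , b , c)) ≡ ∑21-below x xs
  first-at-head = begin
    ∑[ b < suc n ] ∑[ c < suc n ] 𝟙 (is321? w (Fin.zero , b , c))
      ≡⟨ ∑-tail n {λ b → ∑[ c < suc n ] 𝟙 (is321? w (Fin.zero , b , c))}
           (∑-zero (suc n) λ c → 𝟙-no (λ { ((() , _) , _) }) (is321? w (Fin.zero , Fin.zero , c))) ⟩
    ∑[ b < n ] ∑[ c < suc n ] 𝟙 (is321? w (Fin.zero , Fin.suc b , c))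
      ≡⟨ sum-cong-≗ (λ b → ∑-tail n {λ c → 𝟙 (is321? w (Fin.zero , Fin.suc b , c))}
           (𝟙-no (λ { ((_ , ()) , _) }) (is321? w (Fin.zero , Fin.suc b , Fin.zero)))) ⟩
    ∑[ b < n ] ∑[ c < n ] 𝟙 (is321? w (Fin.zero , Fin.suc b , Fin.suc c))
      ≡⟨ sum-cong-≗ (λ b → sum-cong-≗ λ c → 𝟙-cong
           (λ { ((_ , s≤s b<c) , (b<x , c<b)) → (b<c , b<x) , c<b })
           (λ ((b<c , b<x) , c<b) → (s≤s z≤n , s≤s b<c) , (b<x , c<b))
           (is321? w (Fin.zero , Fin.suc b , Fin.suc c)) _) ⟩
    ∑21-below x xs ∎
  first-in-tail : ∀ a → ∑[ b < suc n ] ∑[ c < suc n ] 𝟙 (is321? w (Fin.suc a , b , c))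
                      ≡ ∑[ b < n ] ∑[ c < n ] 𝟙 (is321? xs (a , b , c))
  first-in-tail a = begin
    ∑[ b < suc n ] ∑[ c < suc n ] 𝟙 (is321? w (Fin.suc a , b , c))
      ≡⟨ ∑-tail n {λ b → ∑[ c < suc n ] 𝟙 (is321? w (Fin.suc a , b , c))}
           (∑-zero (suc n) λ c → 𝟙-no (λ { ((() , _) , _) }) (is321? w (Fin.suc a , Fin.zero , c))) ⟩
    ∑[ b < n ] ∑[ c < suc n ] 𝟙 (is321? w (Fin.suc a , Fin.suc b , c))
      ≡⟨ sum-cong-≗ (λ b → ∑-tail n {λ c → 𝟙 (is321? w (Fin.suc a , Fin.suc b , c))}
           (𝟙-no (λ { ((_ , ()) , _) }) (is321? w (Fin.suc a , Fin.suc b , Fin.zero)))) ⟩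
    ∑[ b < n ] ∑[ c < n ] 𝟙 (is321? w (Fin.suc a , Fin.suc b , Fin.suc c))
      ≡⟨ sum-cong-≗ (λ b → sum-cong-≗ λ c → 𝟙-cong
           (λ { ((s≤s a<b , s≤s b<c) , lts) → (a<b , b<c) , lts })
           (λ ((a<b , b<c) , lts) → (s≤s a<b , s≤s b<c) , lts)
           (is321? w (Fin.suc a , Fin.suc b , Fin.suc c)) (is321? xs (a , b , c))) ⟩
    ∑[ b < n ] ∑[ c < n ] 𝟙 (is321? xs (a , b , c)) ∎

∑21-below-step : ∀ x y ys → ∑21-below x (y ∷ ys) ≡ ∑[ c < length ys ] 𝟙 ((y <? x) ×-dec (lookup ys c <? y)) + ∑21-below x ys
∑21-below-step x y ys = cong₂ _+_ top-at-head (sum-cong-≗ top-in-tail)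
  where
  open ≡-Reasoning
  m : ℕ
  m = length ys
  w : List ℕ
  w = y ∷ ys
  below? : (b c : Fin (suc m)) → Dec ((b Fin.< c × lookup w b < x) × lookup w c < lookup w b)
  below? b c = ((b Fin.<? c) ×-dec (lookup w b <? x)) ×-dec (lookup w c <? lookup w b)
  top-at-head : ∑[ c < suc m ] 𝟙 (below? Fin.zero c) ≡ ∑[ c < m ] 𝟙 ((y <? x) ×-dec (lookup ys c <? y))
  top-at-head = begin
    ∑[ c < suc m ] 𝟙 (below? Fin.zero c)
      ≡⟨ ∑-tail m {λ c → 𝟙 (below? Fin.zero c)} (𝟙-no (λ { ((() , _) , _) }) (below? Fin.zero Fin.zero)) ⟩
    ∑[ c < m ] 𝟙 (below? Fin.zero (Fin.suc c))
      ≡⟨ sum-cong-≗ (λ c → 𝟙-cong (λ ((_ , y<x) , c<y) → y<x , c<y) (λ (y<x , c<y) → (s≤s z≤n , y<x) , c<y)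
                                   (below? Fin.zero (Fin.suc c)) ((y <? x) ×-dec (lookup ys c <? y))) ⟩
    ∑[ c < m ] 𝟙 ((y <? x) ×-dec (lookup ys c <? y)) ∎
  top-in-tail : ∀ b → ∑[ c < suc m ] 𝟙 (below? (Fin.suc b) c)
    ≡ ∑[ c < m ] 𝟙 (((b Fin.<? c) ×-dec (lookup ys b <? x)) ×-dec (lookup ys c <? lookup ys b))
  top-in-tail b = begin
    ∑[ c < suc m ] 𝟙 (below? (Fin.suc b) c)
      ≡⟨ ∑-tail m {λ c → 𝟙 (below? (Fin.suc b) c)} (𝟙-no (λ { ((() , _) , _) }) (below? (Fin.suc b) Fin.zero)) ⟩
    ∑[ c < m ] 𝟙 (below? (Fin.suc b) (Fin.suc c))
      ≡⟨ sum-cong-≗ (λ c → 𝟙-cong (λ { ((s≤s b<c , b<x) , c<b) → (b<c , b<x) , c<b })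
                                   (λ ((b<c , b<x) , c<b) → (s≤s b<c , b<x) , c<b)
                                   (below? (Fin.suc b) (Fin.suc c)) _) ⟩
    _ ∎

∑21-below≡#21 : ∀ x ys → ∑21-below x ys ≡ #21 (filter (_<? x) ys)
∑21-below≡#21 x [] = refl
∑21-below≡#21 x (y ∷ ys) = trans (∑21-below-step x y ys) (head-term (y <? x))
  where
  open ≡-Reasoning
  m : ℕ
  m = length ys
  head-term : Dec (y < x) → ∑[ c < m ] 𝟙 ((y <? x) ×-dec (lookup ys c <? y)) + ∑21-below x ys ≡ #21 (filter (_<? x) (y ∷ ys))
  head-term (yes y<x) = begin
    ∑[ c < m ] 𝟙 ((y <? x) ×-dec (lookup ys c <? y)) + ∑21-below x ys
      ≡⟨ cong₂ _+_ (sum-cong-≗ λ c → 𝟙-cong proj₂ (y<x ,_) ((y <? x) ×-dec (lookup ys c <? y)) (lookup ys c <? y))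
                   (∑21-below≡#21 x ys) ⟩
    ∑[ c < m ] 𝟙 (lookup ys c <? y) + #21 (filter (_<? x) ys)
      ≡⟨ cong (_+ #21 (filter (_<? x) ys)) (length-filter-lookup (_<? y) ys) ⟩
    length (filter (_<? y) ys) + #21 (filter (_<? x) ys)
      ≡⟨ cong (λ l → length l + #21 (filter (_<? x) ys)) (filter-absorb (_<? y) (_<? x) ys λ _ z<y → <-trans z<y y<x) ⟨
    #21 (y ∷ filter (_<? x) ys)
      ≡⟨ cong #21 (filter-accept (_<? x) y<x) ⟨
    #21 (filter (_<? x) (y ∷ ys)) ∎
  head-term (no y≮x) = begin
    ∑[ c < m ] 𝟙 ((y <? x) ×-dec (lookup ys c <? y)) + ∑21-below x ys
      ≡⟨ cong₂ _+_ (∑-zero m λ c → 𝟙-no (y≮x ∘ proj₁) ((y <? x) ×-dec (lookup ys c <? y))) (∑21-below≡#21 x ys) ⟩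
    #21 (filter (_<? x) ys)
      ≡⟨ cong #21 (filter-reject (_<? x) y≮x) ⟨
    #21 (filter (_<? x) (y ∷ ys)) ∎

∑321≡#321 : ∀ w → ∑321 w ≡ #321 w
∑321≡#321 [] = refl
∑321≡#321 (x ∷ xs) = trans (∑321-step x xs) (cong₂ _+_ (∑21-below≡#21 x xs) (∑321≡#321 xs))

count321≡#321 : ∀ w → count321 w ≡ #321 w
count321≡#321 w = trans (count321≡∑321 w) (∑321≡#321 w)

Involved : List ℕ → ℕ → Set
Involved p x = Any (λ (a , b , c) → (x ≡ lookup p a ⊎ x ≡ lookup p b) ⊎ x ≡ lookup p c) (copies321 p)

involved? : ∀ p → Decidable (Involved p)
involved? p x = any? (λ (a , b , c) → ((x ≟ lookup p a) ⊎-dec (x ≟ lookup p b)) ⊎-dec (x ≟ lookup p c)) (copies321 p)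

involved321≡filter : ∀ p → Unique p → involved321 p ≡ filter (involved? p) p
involved321≡filter p unique = begin
  map (lookup p) (filter (participates? p) (allFin (length p)))
    ≡⟨ map-filter (lookup p) (participates? p) (involved? p)
         (λ _ → Any.map (Sum.map (Sum.map (cong (lookup p)) (cong (lookup p))) (cong (lookup p))))
         (λ _ → Any.map (Sum.map (Sum.map (lookup-injective unique _ _) (lookup-injective unique _ _)) (lookup-injective unique _ _)))
         (allFin (length p)) ⟩
  filter (involved? p) (map (lookup p) (allFin (length p)))
    ≡⟨ cong (filter (involved? p)) (trans (map-tabulate (λ i → i) (lookup p)) (tabulate-lookup p)) ⟩
  filter (involved? p) p ∎
  where open ≡-Reasoning

[z]⊆⇒position : ∀ {z} {p : List ℕ} → [ z ] ⊆ p → Σ (Pos p) λ c → lookup p c ≡ z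
[z]⊆⇒position (_ ∷ʳ σ) = let (c , eq) = [z]⊆⇒position σ in Fin.suc c , eq
[z]⊆⇒position (refl ∷ _) = Fin.zero , refl

[y,z]⊆⇒positions : ∀ {y z} {p : List ℕ} → (y ∷ z ∷ []) ⊆ p →
  Σ (Pos p) λ b → Σ (Pos p) λ c → b Fin.< c × lookup p b ≡ y × lookup p c ≡ z
[y,z]⊆⇒positions (_ ∷ʳ σ) = let (b , c , b<c , eqs) = [y,z]⊆⇒positions σ in Fin.suc b , Fin.suc c , s≤s b<c , eqs
[y,z]⊆⇒positions (refl ∷ σ) = let (c , eq) = [z]⊆⇒position σ in Fin.zero , Fin.suc c , s≤s z≤n , refl , eq

[x,y,z]⊆⇒positions : ∀ {x y z} {p : List ℕ} → (x ∷ y ∷ z ∷ []) ⊆ p →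
  Σ (Pos p) λ a → Σ (Pos p) λ b → Σ (Pos p) λ c →
    (a Fin.< b × b Fin.< c) × (lookup p a ≡ x × lookup p b ≡ y × lookup p c ≡ z)
[x,y,z]⊆⇒positions (_ ∷ʳ σ) =
  let (a , b , c , (a<b , b<c) , eqs) = [x,y,z]⊆⇒positions σ in Fin.suc a , Fin.suc b , Fin.suc c , (s≤s a<b , s≤s b<c) , eqs
[x,y,z]⊆⇒positions (refl ∷ σ) =
  let (b , c , b<c , eqs) = [y,z]⊆⇒positions σ in Fin.zero , Fin.suc b , Fin.suc c , (s≤s z≤n , s≤s b<c) , refl , eqs

Occurs321⇒Involved : ∀ {p x y z} → Occurs321 p x y z → Involved p x × Involved p y × Involved p z
Occurs321⇒Involved {p} (σ , y<x , z<y) with [x,y,z]⊆⇒positions σ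
... | a , b , c , a<b<c , refl , refl , refl =
  Any.map (λ { refl → inj₁ (inj₁ refl) }) copy , Any.map (λ { refl → inj₁ (inj₂ refl) }) copy , Any.map (λ { refl → inj₂ refl }) copy
  where
  copy : (a , b , c) ∈ copies321 p
  copy = ∈-filter⁺ (is321? p) (∈-cartesianProduct⁺ (∈-allFin a) (∈-cartesianProduct⁺ (∈-allFin b) (∈-allFin c))) (a<b<c , y<x , z<y)

module _ {A : Set} {Q : A → Set} (Q? : Decidable Q) where

  ∑-after : ∀ (q : List A) (b : Fin (length q)) → ∑[ c < length q ] 𝟙 ((b Fin.<? c) ×-dec Q? (lookup q c)) ≡ length (filter Q? (drop (suc (toℕ b)) q))
  ∑-after (x ∷ q) Fin.zero = begin
    ∑[ c < suc (length q) ] 𝟙 ((Fin.zero {length q} Fin.<? c) ×-dec Q? (lookup (x ∷ q) c))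
      ≡⟨ ∑-tail (length q) {λ c → 𝟙 ((Fin.zero {length q} Fin.<? c) ×-dec Q? (lookup (x ∷ q) c))}
           (𝟙-no (λ { (() , _) }) ((Fin.zero {length q} Fin.<? Fin.zero {length q}) ×-dec Q? x)) ⟩
    ∑[ c < length q ] 𝟙 ((Fin.zero {length q} Fin.<? Fin.suc c) ×-dec Q? (lookup q c))
      ≡⟨ sum-cong-≗ (λ c → 𝟙-cong proj₂ (s≤s z≤n ,_) ((Fin.zero {length q} Fin.<? Fin.suc c) ×-dec Q? (lookup q c)) (Q? (lookup q c))) ⟩
    ∑[ c < length q ] 𝟙 (Q? (lookup q c))
      ≡⟨ length-filter-lookup Q? q ⟩
    length (filter Q? q) ∎
    where open ≡-Reasoning
  ∑-after (x ∷ q) (Fin.suc b) = begin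
    ∑[ c < suc (length q) ] 𝟙 ((Fin.suc b Fin.<? c) ×-dec Q? (lookup (x ∷ q) c))
      ≡⟨ ∑-tail (length q) {λ c → 𝟙 ((Fin.suc b Fin.<? c) ×-dec Q? (lookup (x ∷ q) c))}
           (𝟙-no (λ { (() , _) }) ((Fin.suc b Fin.<? Fin.zero {length q}) ×-dec Q? x)) ⟩
    ∑[ c < length q ] 𝟙 ((Fin.suc b Fin.<? Fin.suc c) ×-dec Q? (lookup q c))
      ≡⟨ sum-cong-≗ (λ c → 𝟙-cong (λ { (s≤s b<c , qc) → b<c , qc }) (λ (b<c , qc) → s≤s b<c , qc)
           ((Fin.suc b Fin.<? Fin.suc c) ×-dec Q? (lookup q c)) ((b Fin.<? c) ×-dec Q? (lookup q c))) ⟩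
    ∑[ c < length q ] 𝟙 ((b Fin.<? c) ×-dec Q? (lookup q c))
      ≡⟨ ∑-after q b ⟩
    length (filter Q? (drop (suc (toℕ b)) q)) ∎
    where open ≡-Reasoning

  ∑-before : ∀ (q : List A) (b : Fin (length q)) → ∑[ a < length q ] 𝟙 ((a Fin.<? b) ×-dec Q? (lookup q a)) ≡ length (filter Q? (take (toℕ b) q))
  ∑-before (x ∷ q) Fin.zero = ∑-zero (suc (length q)) λ a → 𝟙-no (λ { (() , _) }) ((a Fin.<? Fin.zero {length q}) ×-dec Q? (lookup (x ∷ q) a))
  ∑-before (x ∷ q) (Fin.suc b) = begin
    𝟙 ((Fin.zero {length q} Fin.<? Fin.suc b) ×-dec Q? x) + ∑[ a < length q ] 𝟙 ((Fin.suc a Fin.<? Fin.suc b) ×-dec Q? (lookup q a))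
      ≡⟨ cong₂ _+_ (𝟙-cong proj₂ (s≤s z≤n ,_) ((Fin.zero {length q} Fin.<? Fin.suc b) ×-dec Q? x) (Q? x))
           (sum-cong-≗ (λ a → 𝟙-cong (λ { (s≤s a<b , qa) → a<b , qa }) (λ (a<b , qa) → s≤s a<b , qa)
             ((Fin.suc a Fin.<? Fin.suc b) ×-dec Q? (lookup q a)) ((a Fin.<? b) ×-dec Q? (lookup q a)))) ⟩
    𝟙 (Q? x) + ∑[ a < length q ] 𝟙 ((a Fin.<? b) ×-dec Q? (lookup q a))
      ≡⟨ cong (𝟙 (Q? x) +_) (∑-before q b) ⟩
    𝟙 (Q? x) + length (filter Q? (take (toℕ b) q))
      ≡⟨ length-filter-∷ Q? x _ ⟨
    length (filter Q? (take (toℕ (Fin.suc b)) (x ∷ q))) ∎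
    where open ≡-Reasoning

rightSmaller≡ : ∀ q b → rightSmaller q b ≡ length (filter (_<? lookup q b) (drop (suc (toℕ b)) q))
rightSmaller≡ q b = trans (length-filter-tabulate (λ c → (b Fin.<? c) ×-dec (lookup q c <? lookup q b)) (λ c → c)) (∑-after (_<? lookup q b) q b)

leftGreater≡ : ∀ q b → leftGreater q b ≡ length (filter (lookup q b <?_) (take (toℕ b) q))
leftGreater≡ q b = trans (length-filter-tabulate (λ a → (a Fin.<? b) ×-dec (lookup q b <? lookup q a)) (λ a → a)) (∑-before (lookup q b <?_) q b)

-- The pivot decomposition

module PivotDecomposition (L : List ℕ) (v : ℕ) (R : List ℕ) where

  aboveL belowR leftWord rightWord : List ℕ
  aboveL = filter (v <?_) L
  belowR = filter (_<? v) R
  leftWord = L ++ belowR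
  rightWord = aboveL ++ R

  #above-leftWord : ∀ a → v < a → length (filter (a <?_) leftWord) ≡ length (filter (a <?_) L)
  #above-leftWord a v<a = begin
    length (filter (a <?_) (L ++ belowR))                         ≡⟨ cong length (filter-++ (a <?_) L belowR) ⟩
    length (filter (a <?_) L ++ filter (a <?_) belowR)            ≡⟨ length-++ (filter (a <?_) L) ⟩
    length (filter (a <?_) L) + length (filter (a <?_) belowR)    ≡⟨ cong (λ l → length (filter (a <?_) L) + length l) none ⟩
    length (filter (a <?_) L) + 0                                 ≡⟨ +-identityʳ _ ⟩
    length (filter (a <?_) L)                                     ∎
    where
    open ≡-Reasoning
    none : filter (a <?_) belowR ≡ []
    none = filter-none (a <?_) (All.tabulate λ x∈ a<x → <-asym (<-trans v<a a<x) (proj₂ (∈-filter⁻ (_<? v) {xs = R} x∈)))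

  #below-rightWord : ∀ c → c < v → length (filter (_<? c) rightWord) ≡ length (filter (_<? c) R)
  #below-rightWord c c<v = begin
    length (filter (_<? c) (aboveL ++ R))                         ≡⟨ cong length (filter-++ (_<? c) aboveL R) ⟩
    length (filter (_<? c) aboveL ++ filter (_<? c) R)            ≡⟨ length-++ (filter (_<? c) aboveL) ⟩
    length (filter (_<? c) aboveL) + length (filter (_<? c) R)    ≡⟨ cong (λ l → length l + length (filter (_<? c) R)) none ⟩
    length (filter (_<? c) R)                                     ∎
    where
    open ≡-Reasoning
    none : filter (_<? c) aboveL ≡ []
    none = filter-none (_<? c) (All.tabulate λ x∈ x<c → <-asym (<-trans x<c c<v) (proj₂ (∈-filter⁻ (v <?_) {xs = L} x∈)))

  #above<aboveL : ∀ {a} → a ∈ L → v < a → length (filter (a <?_) leftWord) < length aboveL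
  #above<aboveL {a} a∈L v<a = begin-strict
    length (filter (a <?_) leftWord)  ≡⟨ #above-leftWord a v<a ⟩
    length (filter (a <?_) L)         <⟨ length-filter-strict (a <?_) (v <?_) L (<-trans v<a) a∈L v<a (<-irrefl refl) ⟩
    length aboveL                     ∎
    where open ≤-Reasoning

  aboveL≤#above : ∀ {a} → a < v → length aboveL ≤ length (filter (a <?_) leftWord)
  aboveL≤#above {a} a<v = begin
    length aboveL                     ≤⟨ length-filter-mono (v <?_) (a <?_) L (<-trans a<v) ⟩
    length (filter (a <?_) L)         ≤⟨ length-mono-≤ (filter-⊆-filter (a <?_) (++⁺ʳ belowR (⊆-refl {x = L}))) ⟩
    length (filter (a <?_) leftWord)  ∎
    where open ≤-Reasoning

  #below<belowR : ∀ {c} → c ∈ R → c < v → length (filter (_<? c) rightWord) < length belowR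
  #below<belowR {c} c∈R c<v = begin-strict
    length (filter (_<? c) rightWord)  ≡⟨ #below-rightWord c c<v ⟩
    length (filter (_<? c) R)          <⟨ length-filter-strict (_<? c) (_<? v) R (λ x<c → <-trans x<c c<v) c∈R c<v (<-irrefl refl) ⟩
    length belowR                      ∎
    where open ≤-Reasoning

  belowR≤#below : ∀ {c} → v < c → length belowR ≤ length (filter (_<? c) rightWord)
  belowR≤#below {c} v<c = begin
    length belowR                      ≤⟨ length-filter-mono (_<? v) (_<? c) R (λ x<v → <-trans x<v v<c) ⟩
    length (filter (_<? c) R)          ≤⟨ length-mono-≤ (filter-⊆-filter (_<? c) (++⁺ˡ aboveL (⊆-refl {x = R}))) ⟩
    length (filter (_<? c) rightWord)  ∎
    where open ≤-Reasoning

≢∧≮⇒< : ∀ {x y : ℕ} → x ≢ y → ¬ y < x → x < y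
≢∧≮⇒< x≢y y≮x = ≤∧≢⇒< (≮⇒≥ y≮x) x≢y

agree-flip : ∀ {x y x′ y′ : ℕ} → x ≢ y → x′ ≢ y′ → (y < x → y′ < x′) × (y′ < x′ → y < x) → (x < y → x′ < y′) × (x′ < y′ → x < y)
agree-flip x≢y x′≢y′ (to , from) =
  (λ x<y → ≢∧≮⇒< x′≢y′ λ y′<x′ → <-asym x<y (from y′<x′)) , (λ x′<y′ → ≢∧≮⇒< x≢y λ y<x → <-asym x′<y′ (to y<x))

module PivotComparison (L : List ℕ) (v : ℕ) (R : List ℕ) (L′ : List ℕ) (v′ : ℕ) (R′ : List ℕ) where

  module D = PivotDecomposition L v R
  module D′ = PivotDecomposition L′ v′ R′

  module _ (v∉L : v ∉ L) (v∉R : v ∉ R) (v′∉L′ : v′ ∉ L′) (v′∉R′ : v′ ∉ R′)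
           (|L|≡ : length L ≡ length L′) (|A|≡ : length D.aboveL ≡ length D′.aboveL) (|C|≡ : length D.belowR ≡ length D′.belowR)
           (left≅ : SamePattern D.leftWord D′.leftWord) (right≅ : SamePattern D.rightWord D′.rightWord) where

    private
      ∈L⇒≢ : ∀ {a} → a ∈ L → a ≢ v
      ∈L⇒≢ a∈L refl = v∉L a∈L
      ∈L′⇒≢ : ∀ {a} → a ∈ L′ → a ≢ v′
      ∈L′⇒≢ a∈L′ refl = v′∉L′ a∈L′
      ∈R⇒≢ : ∀ {c} → c ∈ R → v ≢ c
      ∈R⇒≢ c∈R refl = v∉R c∈R
      ∈R′⇒≢ : ∀ {c} → c ∈ R′ → v′ ≢ c
      ∈R′⇒≢ c∈R′ refl = v′∉R′ c∈R′

      zip-leftWord : zip D.leftWord D′.leftWord ≡ zip L L′ ++ zip D.belowR D′.belowR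
      zip-leftWord = zip-++ L L′ |L|≡
      zip-rightWord : zip D.rightWord D′.rightWord ≡ zip D.aboveL D′.aboveL ++ zip R R′
      zip-rightWord = zip-++ D.aboveL D′.aboveL |A|≡

      inLeft : ∀ {a a′} → (a , a′) ∈ zip L L′ → (a , a′) ∈ zip D.leftWord D′.leftWord
      inLeft m = subst (_ ∈_) (sym zip-leftWord) (∈-++⁺ˡ m)
      inBelow : ∀ {c c′} → (c , c′) ∈ zip D.belowR D′.belowR → (c , c′) ∈ zip D.leftWord D′.leftWord
      inBelow m = subst (_ ∈_) (sym zip-leftWord) (∈-++⁺ʳ (zip L L′) m)
      inAbove : ∀ {a a′} → (a , a′) ∈ zip D.aboveL D′.aboveL → (a , a′) ∈ zip D.rightWord D′.rightWord
      inAbove m = subst (_ ∈_) (sym zip-rightWord) (∈-++⁺ˡ m)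
      inRight : ∀ {c c′} → (c , c′) ∈ zip R R′ → (c , c′) ∈ zip D.rightWord D′.rightWord
      inRight m = subst (_ ∈_) (sym zip-rightWord) (∈-++⁺ʳ (zip D.aboveL D′.aboveL) m)

    above-agrees : ∀ {a a′} → (a , a′) ∈ zip L L′ → (v < a → v′ < a′) × (v′ < a′ → v < a)
    above-agrees {a} {a′} m = to , from
      where
      open ≤-Reasoning
      a∈L : a ∈ L
      a∈L = zip-∈ˡ L L′ m
      a′∈L′ : a′ ∈ L′
      a′∈L′ = zip-∈ʳ L L′ m
      #above≡ : length (filter (a <?_) D.leftWord) ≡ length (filter (a′ <?_) D′.leftWord)
      #above≡ = SamePattern-#above left≅ (inLeft m)
      to : v < a → v′ < a′
      to v<a with v′ <? a′
      ... | yes v′<a′ = v′<a′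
      ... | no v′≮a′ = ⊥-elim (<⇒≱ (D.#above<aboveL a∈L v<a) (begin
        length D.aboveL                             ≡⟨ |A|≡ ⟩
        length D′.aboveL                            ≤⟨ D′.aboveL≤#above (≢∧≮⇒< (∈L′⇒≢ a′∈L′) v′≮a′) ⟩
        length (filter (a′ <?_) D′.leftWord)        ≡⟨ #above≡ ⟨
        length (filter (a <?_) D.leftWord)          ∎))
      from : v′ < a′ → v < a
      from v′<a′ with v <? a
      ... | yes v<a = v<a
      ... | no v≮a = ⊥-elim (<⇒≱ (D′.#above<aboveL a′∈L′ v′<a′) (begin
        length D′.aboveL                            ≡⟨ |A|≡ ⟨
        length D.aboveL                             ≤⟨ D.aboveL≤#above (≢∧≮⇒< (∈L⇒≢ a∈L) v≮a) ⟩
        length (filter (a <?_) D.leftWord)          ≡⟨ #above≡ ⟩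
        length (filter (a′ <?_) D′.leftWord)        ∎))

    below-agrees : ∀ {c c′} → (c , c′) ∈ zip R R′ → (c < v → c′ < v′) × (c′ < v′ → c < v)
    below-agrees {c} {c′} m = to , from
      where
      open ≤-Reasoning
      c∈R : c ∈ R
      c∈R = zip-∈ˡ R R′ m
      c′∈R′ : c′ ∈ R′
      c′∈R′ = zip-∈ʳ R R′ m
      #below≡ : length (filter (_<? c) D.rightWord) ≡ length (filter (_<? c′) D′.rightWord)
      #below≡ = SamePattern-#below right≅ (inRight m)
      to : c < v → c′ < v′
      to c<v with c′ <? v′
      ... | yes c′<v′ = c′<v′
      ... | no c′≮v′ = ⊥-elim (<⇒≱ (D.#below<belowR c∈R c<v) (begin
        length D.belowR                             ≡⟨ |C|≡ ⟩
        length D′.belowR                            ≤⟨ D′.belowR≤#below (≢∧≮⇒< (∈R′⇒≢ c′∈R′) c′≮v′) ⟩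
        length (filter (_<? c′) D′.rightWord)       ≡⟨ #below≡ ⟨
        length (filter (_<? c) D.rightWord)         ∎))
      from : c′ < v′ → c < v
      from c′<v′ with c <? v
      ... | yes c<v = c<v
      ... | no c≮v = ⊥-elim (<⇒≱ (D′.#below<belowR c′∈R′ c′<v′) (begin
        length D′.belowR                            ≡⟨ |C|≡ ⟨
        length D.belowR                             ≤⟨ D.belowR≤#below (≢∧≮⇒< (∈R⇒≢ c∈R) c≮v) ⟩
        length (filter (_<? c) D.rightWord)         ≡⟨ #below≡ ⟩
        length (filter (_<? c′) D′.rightWord)       ∎))

    private
      aboveL-pair : ∀ {a a′} → (a , a′) ∈ zip L L′ → v < a → (a , a′) ∈ zip D.rightWord D′.rightWord
      aboveL-pair m v<a = inAbove (∈-zip-filter (v <?_) (v′ <?_) L L′ above-agrees m v<a)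
      belowR-pair : ∀ {c c′} → (c , c′) ∈ zip R R′ → c < v → (c , c′) ∈ zip D.leftWord D′.leftWord
      belowR-pair m c<v = inBelow (∈-zip-filter (_<? v) (_<? v′) R R′ below-agrees m c<v)
      below-pivot : ∀ {a a′} → (a , a′) ∈ zip L L′ → ¬ v < a → a < v × a′ < v′
      below-pivot m v≮a = let a<v = ≢∧≮⇒< (∈L⇒≢ (zip-∈ˡ L L′ m)) v≮a in
        a<v , proj₁ (agree-flip (∈L⇒≢ (zip-∈ˡ L L′ m)) (∈L′⇒≢ (zip-∈ʳ L L′ m)) (above-agrees m)) a<v
      above-pivot : ∀ {c c′} → (c , c′) ∈ zip R R′ → ¬ c < v → v < c × v′ < c′
      above-pivot m c≮v = let v<c = ≢∧≮⇒< (∈R⇒≢ (zip-∈ˡ R R′ m)) c≮v in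
        v<c , proj₁ (agree-flip (∈R⇒≢ (zip-∈ˡ R R′ m)) (∈R′⇒≢ (zip-∈ʳ R R′ m)) (below-agrees m)) v<c

    L-vs-R : ∀ {a a′ c c′} → (a , a′) ∈ zip L L′ → (c , c′) ∈ zip R R′ → (a < c → a′ < c′) × (a′ < c′ → a < c)
    L-vs-R {a} {c = c} ma mc with v <? a | c <? v
    ... | yes v<a | _ = proj₂ right≅ (aboveL-pair ma v<a) (inRight mc)
    ... | no _ | yes c<v = proj₂ left≅ (inLeft ma) (belowR-pair mc c<v)
    ... | no v≮a | no c≮v =
      let (a<v , a′<v′) = below-pivot ma v≮a ; (v<c , v′<c′) = above-pivot mc c≮v in
      (λ _ → <-trans a′<v′ v′<c′) , (λ _ → <-trans a<v v<c)

    R-vs-L : ∀ {a a′ c c′} → (a , a′) ∈ zip L L′ → (c , c′) ∈ zip R R′ → (c < a → c′ < a′) × (c′ < a′ → c < a)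
    R-vs-L {a} {c = c} ma mc with v <? a | c <? v
    ... | yes v<a | _ = proj₂ right≅ (inRight mc) (aboveL-pair ma v<a)
    ... | no _ | yes c<v = proj₂ left≅ (belowR-pair mc c<v) (inLeft ma)
    ... | no v≮a | no c≮v =
      let (a<v , a′<v′) = below-pivot ma v≮a ; (v<c , v′<c′) = above-pivot mc c≮v in
      (λ c<a → ⊥-elim (<-asym (<-trans a<v v<c) c<a)) , (λ c′<a′ → ⊥-elim (<-asym (<-trans a′<v′ v′<c′) c′<a′))

    private
      block : ∀ {z} → z ∈ zip L L′ ++ (v , v′) ∷ zip R R′ → z ∈ zip L L′ ⊎ z ≡ (v , v′) ⊎ z ∈ zip R R′
      block m with ∈-++⁻ (zip L L′) m
      ... | inj₁ mL = inj₁ mL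
      ... | inj₂ (here refl) = inj₂ (inj₁ refl)
      ... | inj₂ (there mR) = inj₂ (inj₂ mR)

    OrderIso-split : OrderIso (zip L L′ ++ (v , v′) ∷ zip R R′)
    OrderIso-split mx my with block mx | block my
    ... | inj₁ ma | inj₁ mb = proj₂ left≅ (inLeft ma) (inLeft mb)
    ... | inj₁ ma | inj₂ (inj₁ refl) = agree-flip (∈L⇒≢ (zip-∈ˡ L L′ ma)) (∈L′⇒≢ (zip-∈ʳ L L′ ma)) (above-agrees ma)
    ... | inj₁ ma | inj₂ (inj₂ mc) = L-vs-R ma mc
    ... | inj₂ (inj₁ refl) | inj₁ mb = above-agrees mb
    ... | inj₂ (inj₁ refl) | inj₂ (inj₁ refl) = (λ v<v → ⊥-elim (<-irrefl refl v<v)) , (λ v′<v′ → ⊥-elim (<-irrefl refl v′<v′))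
    ... | inj₂ (inj₁ refl) | inj₂ (inj₂ mc) = agree-flip (∈R⇒≢ (zip-∈ˡ R R′ mc)) (∈R′⇒≢ (zip-∈ʳ R R′ mc)) (below-agrees mc)
    ... | inj₂ (inj₂ mc) | inj₁ mb = R-vs-L mb mc
    ... | inj₂ (inj₂ mc) | inj₂ (inj₁ refl) = below-agrees mc
    ... | inj₂ (inj₂ mc) | inj₂ (inj₂ md) = proj₂ right≅ (inRight mc) (inRight md)

-- The injection

module Pivot (q : List ℕ) (b₁ : Pos q) (b₁-plays-two : PlaysTwo q b₁) where

  m : ℕ
  m = toℕ b₁
  β : ℕ
  β = lookup q b₁
  qL qR : List ℕ
  qL = take m q
  qR = drop (suc m) q

  s t : ℕ
  s = #321 (qL ++ filter (_<? β) qR)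
  t = #321 (filter (β <?_) qL ++ qR)

  q-split : q ≡ qL ++ β ∷ qR
  q-split = split-at q b₁

  private
    a₀ c₀ : Pos q
    a₀ = proj₁ b₁-plays-two
    c₀ = proj₁ (proj₂ b₁-plays-two)
    copy₀ : Is321 q a₀ b₁ c₀
    copy₀ = proj₂ (proj₂ b₁-plays-two)

  #321-without-β : #321 (qL ++ qR) < #321 q
  #321-without-β = subst (λ q′ → #321 (qL ++ qR) < #321 q′) (sym q-split)
    (#321-insert-strict qL β qR (∈-take q (proj₁ (proj₁ copy₀))) (proj₁ (proj₂ copy₀)) (∈-drop q (proj₂ (proj₁ copy₀))) (proj₂ (proj₂ copy₀)))

  s<#321 : s < #321 q
  s<#321 = ≤-<-trans (#321-mono (++⁺ (⊆-refl {x = qL}) (filter-⊆ (_<? β) qR))) #321-without-β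

  t<#321 : t < #321 q
  t<#321 = ≤-<-trans (#321-mono (++⁺ (filter-⊆ (β <?_) qL) (⊆-refl {x = qR}))) #321-without-β

  -- The entry of p playing the role of β: the m-th entry of p involved in a 321.
  pivot : List ℕ → ℕ
  pivot p = involved321 p ! m

  leftOf rightOf : List ℕ → List ℕ
  leftOf p = proj₁ (breakAt (pivot p) p)
  rightOf p = proj₂ (breakAt (pivot p) p)

  φ : List ℕ → ℕ × (List ℕ × List ℕ)
  φ p = suc (length (leftOf p)) , reduce leftWord , reduce rightWord
    where open PivotDecomposition (leftOf p) (pivot p) (rightOf p)

  module OfTypeQ {n p} (perm : IsPerm n p) (type : OfType q p) where

    open PivotDecomposition (leftOf p) (pivot p) (rightOf p) public

    v : ℕ
    v = pivot p
    L R I IL IR : List ℕ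
    L = leftOf p
    R = rightOf p
    I = involved321 p
    IL = take m I
    IR = drop (suc m) I

    unique : Unique p
    unique = IsPerm-unique perm

    I≡filter : I ≡ filter (involved? p) p
    I≡filter = involved321≡filter p unique

    I≅q : SamePattern I q
    I≅q = subst (SamePattern I) type (SamePattern-reduce I)

    m<|I| : m < length I
    m<|I| = subst (m <_) (sym (proj₁ I≅q)) (toℕ<n b₁)

    I-split : I ≡ IL ++ v ∷ IR
    I-split = split-index m I m<|I|

    |IL|≡|qL| : length IL ≡ length qL
    |IL|≡|qL| = trans (length-take-≤ m I (<⇒≤ m<|I|)) (sym (length-take-≤ m q (<⇒≤ (toℕ<n b₁))))

    |IR|≡|qR| : length IR ≡ length qR
    |IR|≡|qR| = trans (length-drop (suc m) I) (trans (cong (_∸ suc m) (proj₁ I≅q)) (sym (length-drop (suc m) q)))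

    zip-I-q : zip I q ≡ zip IL qL ++ (v , β) ∷ zip IR qR
    zip-I-q = trans (cong₂ zip I-split q-split) (zip-++ IL qL |IL|≡|qL|)

    I-q-iso : OrderIso (zip IL qL ++ (v , β) ∷ zip IR qR)
    I-q-iso = subst OrderIso zip-I-q (proj₂ I≅q)

    private
      inIL : ∀ {a a′} → (a , a′) ∈ zip IL qL → (a , a′) ∈ zip IL qL ++ (v , β) ∷ zip IR qR
      inIL = ∈-++⁺ˡ
      inV : (v , β) ∈ zip IL qL ++ (v , β) ∷ zip IR qR
      inV = ∈-++⁺ʳ (zip IL qL) (here refl)
      inIR : ∀ {c c′} → (c , c′) ∈ zip IR qR → (c , c′) ∈ zip IL qL ++ (v , β) ∷ zip IR qR
      inIR = ∈-++⁺ʳ (zip IL qL) ∘ there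

    v∈p×involved : v ∈ p × Involved p v
    v∈p×involved = ∈-filter⁻ (involved? p) (subst (v ∈_) (trans (sym I-split) I≡filter) (∈-++⁺ʳ IL (here refl)))

    p-split : p ≡ L ++ v ∷ R
    p-split = proj₁ (breakAt-split v p (proj₁ v∈p×involved))

    v∉L : v ∉ L
    v∉L = proj₂ (breakAt-split v p (proj₁ v∈p×involved))

    v∉R : v ∉ R
    v∉R = proj₂ (Unique-middle L (subst Unique p-split unique))

    I-parts : IL ≡ filter (involved? p) L × IR ≡ filter (involved? p) R
    I-parts = ++-∷-cancel IL IR (filter (involved? p) L) (filter (involved? p) R) I-split′ v∉IL v∉filterL
      where
      I-split′ : IL ++ v ∷ IR ≡ filter (involved? p) L ++ v ∷ filter (involved? p) R
      I-split′ = begin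
        IL ++ v ∷ IR                                            ≡⟨ trans (sym I-split) I≡filter ⟩
        filter (involved? p) p                                  ≡⟨ cong (filter (involved? p)) p-split ⟩
        filter (involved? p) (L ++ v ∷ R)                       ≡⟨ filter-++ (involved? p) L (v ∷ R) ⟩
        filter (involved? p) L ++ filter (involved? p) (v ∷ R)  ≡⟨ cong (filter (involved? p) L ++_) (filter-accept (involved? p) (proj₂ v∈p×involved)) ⟩
        filter (involved? p) L ++ v ∷ filter (involved? p) R    ∎
        where open ≡-Reasoning
      v∉IL : v ∉ IL
      v∉IL = proj₁ (Unique-middle IL (subst Unique (trans (sym I≡filter) I-split) (Unique.filter⁺ (involved? p) unique)))
      v∉filterL : v ∉ filter (involved? p) L
      v∉filterL = v∉L ∘ proj₁ ∘ ∈-filter⁻ (involved? p)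

    IL⊆L : IL ⊆ L
    IL⊆L = subst (_⊆ L) (sym (proj₁ I-parts)) (filter-⊆ (involved? p) L)

    IR⊆R : IR ⊆ R
    IR⊆R = subst (_⊆ R) (sym (proj₂ I-parts)) (filter-⊆ (involved? p) R)

    -- The entries of p corresponding to the outer entries of a 321 of q through β.
    private
      a-partner : ∃[ a ] (a , lookup q a₀) ∈ zip IL qL
      a-partner = ∈-zipʳ IL qL |IL|≡|qL| (∈-take q (proj₁ (proj₁ copy₀)))
      c-partner : ∃[ c ] (c , lookup q c₀) ∈ zip IR qR
      c-partner = ∈-zipʳ IR qR |IR|≡|qR| (∈-drop q (proj₂ (proj₁ copy₀)))
      a∈L : proj₁ a-partner ∈ L
      a∈L = Any-resp-⊆ IL⊆L (zip-∈ˡ IL qL (proj₂ a-partner))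
      v<a : v < proj₁ a-partner
      v<a = proj₂ (I-q-iso inV (inIL (proj₂ a-partner))) (proj₁ (proj₂ copy₀))
      c∈R : proj₁ c-partner ∈ R
      c∈R = Any-resp-⊆ IR⊆R (zip-∈ˡ IR qR (proj₂ c-partner))
      c<v : proj₁ c-partner < v
      c<v = proj₂ (I-q-iso (inIR (proj₂ c-partner)) inV) (proj₂ (proj₂ copy₀))

    through-v : ∀ {x z} → x ∈ L → z ∈ R → (x ∷ v ∷ z ∷ []) ⊆ p
    through-v {x} {z} x∈L z∈R = subst ((x ∷ v ∷ z ∷ []) ⊆_) (sym p-split) (++⁺ (from∈ x∈L) (refl ∷ from∈ z∈R))

    belowR-involved : ∀ {c} → c ∈ R → c < v → Involved p c
    belowR-involved c∈R c<v = proj₂ (proj₂ (Occurs321⇒Involved (through-v a∈L c∈R , v<a , c<v)))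

    aboveL-involved : ∀ {a} → a ∈ L → v < a → Involved p a
    aboveL-involved a∈L v<a = proj₁ (Occurs321⇒Involved (through-v a∈L c∈R , v<a , c<v))

    belowR≡ : belowR ≡ filter (_<? v) IR
    belowR≡ = trans (sym (filter-absorb (_<? v) (involved? p) R belowR-involved)) (cong (filter (_<? v)) (sym (proj₂ I-parts)))

    aboveL≡ : aboveL ≡ filter (v <?_) IL
    aboveL≡ = trans (sym (filter-absorb (v <?_) (involved? p) L aboveL-involved)) (cong (filter (v <?_)) (sym (proj₁ I-parts)))

    zip-belowR : zip belowR (filter (_<? β) qR) ⊆ zip IR qR × length belowR ≡ length (filter (_<? β) qR)
    zip-belowR = subst (λ l → zip l (filter (_<? β) qR) ⊆ zip IR qR × length l ≡ length (filter (_<? β) qR)) (sym belowR≡)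
      (zip-filter (_<? v) (_<? β) IR qR |IR|≡|qR| (λ mm → I-q-iso (inIR mm) inV))

    zip-aboveL : zip aboveL (filter (β <?_) qL) ⊆ zip IL qL × length aboveL ≡ length (filter (β <?_) qL)
    zip-aboveL = subst (λ l → zip l (filter (β <?_) qL) ⊆ zip IL qL × length l ≡ length (filter (β <?_) qL)) (sym aboveL≡)
      (zip-filter (v <?_) (β <?_) IL qL |IL|≡|qL| (λ mm → I-q-iso inV (inIL mm)))

    |belowR|≡ : length belowR ≡ rightSmaller q b₁
    |belowR|≡ = trans (proj₂ zip-belowR) (sym (rightSmaller≡ q b₁))

    |aboveL|≡ : length aboveL ≡ leftGreater q b₁
    |aboveL|≡ = trans (proj₂ zip-aboveL) (sym (leftGreater≡ q b₁))

    leftWord⊆p : leftWord ⊆ p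
    leftWord⊆p = subst (leftWord ⊆_) (sym p-split) (++⁺ (⊆-refl {x = L}) (v ∷ʳ filter-⊆ (_<? v) R))

    rightWord⊆p : rightWord ⊆ p
    rightWord⊆p = subst (rightWord ⊆_) (sym p-split) (++⁺ (filter-⊆ (v <?_) L) (v ∷ʳ ⊆-refl {x = R}))

    #321-involved : ∀ {w} → w ⊆ p → #321 w ≡ #321 (filter (involved? p) w)
    #321-involved {w} σ = #321-restrict (involved? p) w λ (τ , lts) → Occurs321⇒Involved (⊆-trans τ σ , lts)

    leftWord-involved : filter (involved? p) leftWord ≡ IL ++ belowR
    leftWord-involved = trans (filter-++ (involved? p) L belowR) (cong₂ _++_ (sym (proj₁ I-parts)) (filter-all (involved? p)
      (All.tabulate λ c∈ → let (c∈R , c<v) = ∈-filter⁻ (_<? v) {xs = R} c∈ in belowR-involved c∈R c<v)))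

    rightWord-involved : filter (involved? p) rightWord ≡ aboveL ++ IR
    rightWord-involved = trans (filter-++ (involved? p) aboveL R) (cong₂ _++_ (filter-all (involved? p)
      (All.tabulate λ a∈ → let (a∈L , v<a) = ∈-filter⁻ (v <?_) {xs = L} a∈ in aboveL-involved a∈L v<a)) (sym (proj₂ I-parts)))

    left-pattern : SamePattern (IL ++ belowR) (qL ++ filter (_<? β) qR)
    left-pattern = lengths , OrderIso-⊆ (subst (_⊆ zip IL qL ++ (v , β) ∷ zip IR qR) (sym (zip-++ IL qL |IL|≡|qL|)) (++⁺ ⊆-refl ((v , β) ∷ʳ proj₁ zip-belowR))) I-q-iso
      where
      lengths : length (IL ++ belowR) ≡ length (qL ++ filter (_<? β) qR)
      lengths = trans (length-++ IL) (trans (cong₂ _+_ |IL|≡|qL| (proj₂ zip-belowR)) (sym (length-++ qL)))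

    right-pattern : SamePattern (aboveL ++ IR) (filter (β <?_) qL ++ qR)
    right-pattern = lengths , OrderIso-⊆ (subst (_⊆ zip IL qL ++ (v , β) ∷ zip IR qR) (sym (zip-++ aboveL _ (proj₂ zip-aboveL))) (++⁺ (proj₁ zip-aboveL) ((v , β) ∷ʳ ⊆-refl))) I-q-iso
      where
      lengths : length (aboveL ++ IR) ≡ length (filter (β <?_) qL ++ qR)
      lengths = trans (length-++ aboveL) (trans (cong₂ _+_ (proj₂ zip-aboveL) |IR|≡|qR|) (sym (length-++ (filter (β <?_) qL))))

    count-left : count321 (reduce leftWord) ≡ s
    count-left = begin
      count321 (reduce leftWord)              ≡⟨ count321≡#321 (reduce leftWord) ⟩
      #321 (reduce leftWord)                  ≡⟨ #321-pattern _ _ (SamePattern-reduce leftWord) ⟨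
      #321 leftWord                           ≡⟨ #321-involved leftWord⊆p ⟩
      #321 (filter (involved? p) leftWord)    ≡⟨ cong #321 leftWord-involved ⟩
      #321 (IL ++ belowR)                     ≡⟨ #321-pattern _ _ left-pattern ⟩
      s                                       ∎
      where open ≡-Reasoning

    count-right : count321 (reduce rightWord) ≡ t
    count-right = begin
      count321 (reduce rightWord)             ≡⟨ count321≡#321 (reduce rightWord) ⟩
      #321 (reduce rightWord)                 ≡⟨ #321-pattern _ _ (SamePattern-reduce rightWord) ⟨
      #321 rightWord                          ≡⟨ #321-involved rightWord⊆p ⟩
      #321 (filter (involved? p) rightWord)   ≡⟨ cong #321 rightWord-involved ⟩
      #321 (aboveL ++ IR)                     ≡⟨ #321-pattern _ _ right-pattern ⟩
      t                                       ∎
      where open ≡-Reasoning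

    count-p : count321 p ≡ #321 q
    count-p = begin
      count321 p                        ≡⟨ count321≡#321 p ⟩
      #321 p                            ≡⟨ #321-involved (⊆-refl {x = p}) ⟩
      #321 (filter (involved? p) p)     ≡⟨ cong #321 I≡filter ⟨
      #321 I                            ≡⟨ #321-pattern I q I≅q ⟩
      #321 q                            ∎
      where open ≡-Reasoning

    n≡ : n ≡ suc (length L + length R)
    n≡ = begin
      n                              ≡⟨ IsPerm-length perm ⟨
      length p                       ≡⟨ cong length p-split ⟩
      length (L ++ v ∷ R)            ≡⟨ length-++ L ⟩
      length L + suc (length R)      ≡⟨ +-suc (length L) (length R) ⟩
      suc (length L + length R)      ∎
      where open ≡-Reasoning

    position-bounds : 1 ≤ suc (length L) × suc (length L) ≤ n
    position-bounds = s≤s z≤n , subst (suc (length L) ≤_) (sym n≡) (s≤s (m≤m+n (length L) (length R)))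

    perm-left : IsPerm (length L + rightSmaller q b₁) (reduce leftWord)
    perm-left = subst (λ k → IsPerm k (reduce leftWord)) (trans (length-++ L) (cong (length L +_) |belowR|≡))
      (reduce-IsPerm leftWord (Unique-⊆ leftWord⊆p unique))

    perm-right : IsPerm ((n ∸ suc (length L)) + leftGreater q b₁) (reduce rightWord)
    perm-right = subst (λ k → IsPerm k (reduce rightWord)) |rightWord|≡ (reduce-IsPerm rightWord (Unique-⊆ rightWord⊆p unique))
      where
      open ≡-Reasoning
      |rightWord|≡ : length rightWord ≡ (n ∸ suc (length L)) + leftGreater q b₁
      |rightWord|≡ = begin
        length (aboveL ++ R)                        ≡⟨ length-++ aboveL ⟩
        length aboveL + length R                    ≡⟨ +-comm (length aboveL) (length R) ⟩
        length R + length aboveL                    ≡⟨ cong₂ _+_ (sym (m+n∸m≡n (suc (length L)) (length R))) |aboveL|≡ ⟩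
        (suc (length L + length R) ∸ suc (length L)) + leftGreater q b₁
                                                    ≡⟨ cong (λ k → (k ∸ suc (length L)) + leftGreater q b₁) n≡ ⟨
        (n ∸ suc (length L)) + leftGreater q b₁     ∎

  φ-injective : ∀ {n p p′} → IsPerm n p → OfType q p → IsPerm n p′ → OfType q p′ → φ p ≡ φ p′ → p ≡ p′
  φ-injective {p = p} {p′} perm type perm′ type′ φ≡ = IsPerm-pattern-injective perm perm′ p-p′-iso
    where
    module X = OfTypeQ perm type
    module Y = OfTypeQ perm′ type′
    |L|≡ : length X.L ≡ length Y.L
    |L|≡ = suc-injective (cong proj₁ φ≡)
    p-p′-iso : OrderIso (zip p p′)
    p-p′-iso = subst OrderIso (sym (trans (cong₂ zip X.p-split Y.p-split) (zip-++ X.L Y.L |L|≡)))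
      (PivotComparison.OrderIso-split X.L X.v X.R Y.L Y.v Y.R X.v∉L X.v∉R Y.v∉L Y.v∉R |L|≡
        (trans X.|aboveL|≡ (sym Y.|aboveL|≡)) (trans X.|belowR|≡ (sym Y.|belowR|≡))
        (reduce-injective X.leftWord Y.leftWord (cong (proj₁ ∘ proj₂) φ≡))
        (reduce-injective X.rightWord Y.rightWord (cong (proj₂ ∘ proj₂) φ≡)))

mainTheorem1 : (n r : ℕ) → 1 ≤ r → (q : List ℕ) → IsPerm (length q) q →
    (∃[ p ] InSq n r q p) →
    (b₁ : Pos q) → IsFirstTwo q b₁ →
    ∃[ s ] ∃[ t ] (s < r × t < r ×
      Σ (Σ (List ℕ) (InSq n r q) → ℕ × (List ℕ × List ℕ)) λ φ →
        (∀ x → (1 ≤ proj₁ (φ x) × proj₁ (φ x) ≤ n)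
             × (InS ((proj₁ (φ x) ∸ 1) + rightSmaller q b₁) s (proj₁ (proj₂ (φ x)))
               × InS ((n ∸ proj₁ (φ x)) + leftGreater q b₁) t (proj₂ (proj₂ (φ x)))))
        × (∀ x y → φ x ≡ φ y → proj₁ x ≡ proj₁ y))
mainTheorem1 n r _ q _ (p₀ , perm₀ , type₀ , count₀) b₁ (plays-two , _) =
  s , t , subst (s <_) #321q≡r s<#321 , subst (t <_) #321q≡r t<#321 , φ ∘ proj₁ , properties , injective
  where
  open Pivot q b₁ plays-two
  #321q≡r : #321 q ≡ r
  #321q≡r = trans (sym (OfTypeQ.count-p perm₀ type₀)) count₀
  properties : ∀ x → (1 ≤ proj₁ (φ (proj₁ x)) × proj₁ (φ (proj₁ x)) ≤ n)
    × (InS ((proj₁ (φ (proj₁ x)) ∸ 1) + rightSmaller q b₁) s (proj₁ (proj₂ (φ (proj₁ x))))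
      × InS ((n ∸ proj₁ (φ (proj₁ x))) + leftGreater q b₁) t (proj₂ (proj₂ (φ (proj₁ x)))))
  properties (p , perm , type , _) = position-bounds , (perm-left , count-left) , (perm-right , count-right)
    where open OfTypeQ perm type
  injective : ∀ x y → φ (proj₁ x) ≡ φ (proj₁ y) → proj₁ x ≡ proj₁ y
  injective (_ , perm , type , _) (_ , perm′ , type′ , _) = φ-injective perm type perm′ type′
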